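{- Let $n\ge 2$. If $S\in\{\{g,o\},\{r,s\},\{b,y\}\}$ then \[F(J(T_n(S)),q)=\prod_{j=1}^n {n\brack j}_q=\prod_{1\le i\le j\le k\le n-1}\frac{[j+1]_q}{[j]_q}.\]
   Context: Let $T_n$ be the set of triples $(c_1,c_2,c_3)$ of nonnegative integers with $c_1+c_2+c_3\le n-2$. To the colors $r,g,y,b,o,s$ associate $v_r=(1,0,0)$, $v_g=(0,1,0)$, $v_y=(0,0,1)$, $v_b=(-1,1,0)$, $v_o=(-1,0,1)$, $v_s=(0,1,-1)$. For a set $S$ of colors, $T_n(S)$ is the poset on $T_n$ whose order is the reflexive–transitive closure of $p<p+v_x$ for $x\in S$ and $p,p+v_x\in T_n$. $J(P)$ is the set of order ideals (down-closed subsets, including $\emptyset$) of $P$, and $F(J(P),q)=\sum_{I\in J(P)}q^{|I|}$. Here $[m]_q=1+q+\dots+q^{m-1}$, $m!_q=[1]_q\cdots[m]_q$, and ${n\brack j}_q=\frac{n!_q}{j!_q\,(n-j)!_q}$. -}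

module Defs where

open import Data.Nat using (ℕ; zero; suc; _+_; _*_; _∸_; _^_; _≤_; NonZero)
open import Data.Nat.Properties using (m*n≢0)
open import Data.Integer using (+_)
open import Data.Rational using (ℚ; _/_; 1ℚ) renaming (_*_ to _*ℚ_)
open import Data.List using (List; []; _∷_; map; concatMap; upTo; foldr; length; lookup)
open import Data.Nat.ListAction using (sum; product)
open import Data.List.Membership.Propositional using (_∈_)
open import Data.Fin using (Fin)
open import Data.Fin.Subset using (Subset; ∣_∣) renaming (_∈_ to _∈ₛ_)
open import Data.Product using (_×_; _,_; Σ)
open import Relation.Binary.Construct.Closure.ReflexiveTransitive using (Star)

Pt : Set
Pt = ℕ × ℕ × ℕ

InT : ℕ → Pt → Set
InT n (a , b , c) = a + b + c ≤ n ∸ 2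

ptsT : ℕ → List Pt
ptsT n = concatMap (λ a → concatMap (λ b → map (λ c → (a , b , c))
                        (upTo (suc (m ∸ a ∸ b))))
                     (upTo (suc (m ∸ a))))
           (upTo (suc m))
  where m = n ∸ 2

sizeT : ℕ → ℕ
sizeT n = length (ptsT n)

elt : (n : ℕ) → Fin (sizeT n) → Pt
elt n i = lookup (ptsT n) i

data Color : Set where
  r g y b o s : Color

-- Step x p p'  means  p' = p + v_x  (written out coordinatewise):
-- v_r=(1,0,0), v_g=(0,1,0), v_y=(0,0,1), v_b=(-1,1,0), v_o=(-1,0,1), v_s=(0,1,-1)
data Step : Color → Pt → Pt → Set where
  step-r : ∀ {u v w} → Step r (u , v , w) (suc u , v , w)
  step-g : ∀ {u v w} → Step g (u , v , w) (u , suc v , w)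
  step-y : ∀ {u v w} → Step y (u , v , w) (u , v , suc w)
  step-b : ∀ {u v w} → Step b (suc u , v , w) (u , suc v , w)
  step-o : ∀ {u v w} → Step o (suc u , v , w) (u , v , suc w)
  step-s : ∀ {u v w} → Step s (u , v , suc w) (u , suc v , w)

Gen : ℕ → List Color → Pt → Pt → Set
Gen n S p p' = Σ Color (λ x → (x ∈ S) × Step x p p' × InT n p × InT n p')

_≼[_,_]_ : Pt → ℕ → List Color → Pt → Set
p ≼[ n , S ] p' = Star (Gen n S) p p'

IsIdeal : (n : ℕ) → List Color → Subset (sizeT n) → Set
IsIdeal n S I = ∀ (i j : Fin (sizeT n)) → elt n j ≼[ n , S ] elt n i →
                i ∈ₛ I → j ∈ₛ I

qint : ℕ → ℕ → ℕ
qint m q = sum (map (q ^_) (upTo m))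

qfact : ℕ → ℕ → ℕ
qfact m q = product (map (λ i → qint (suc i) q) (upTo m))

qint-suc-nonZero : ∀ m q → NonZero (qint (suc m) q)
qint-suc-nonZero m q = _

prod-nonZero : (xs : List ℕ) → (∀ {x} → x ∈ xs → NonZero x) → NonZero (product xs)
prod-nonZero [] h = _
prod-nonZero (x ∷ xs) h =
  m*n≢0 x (product xs) {{h (Data.List.Relation.Unary.Any.here refl)}}
        {{prod-nonZero xs (λ m → h (Data.List.Relation.Unary.Any.there m))}}
  where open import Relation.Binary.PropositionalEquality using (refl)
        import Data.List.Relation.Unary.Any

qfact-nonZero : ∀ m q → NonZero (qfact m q)
qfact-nonZero m q = prod-nonZero _ aux
  where
  open import Data.List.Membership.Propositional.Properties using (∈-map⁻)
  open import Relation.Binary.PropositionalEquality using (refl)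
  aux : ∀ {x} → x ∈ map (λ i → qint (suc i) q) (upTo m) → NonZero x
  aux x∈ with ∈-map⁻ (λ i → qint (suc i) q) x∈
  ... | i , _ , refl = qint-suc-nonZero i q

prodℚ : List ℚ → ℚ
prodℚ = foldr _*ℚ_ 1ℚ

qbinom : ℕ → ℕ → ℕ → ℚ
qbinom n j q = _/_ (+ qfact n q) (qfact j q * qfact (n ∸ j) q)
                 {{m*n≢0 (qfact j q) (qfact (n ∸ j) q)
                    {{qfact-nonZero j q}} {{qfact-nonZero (n ∸ j) q}}}}

prodBinom : ℕ → ℕ → ℚ
prodBinom n q = prodℚ (map (λ j' → qbinom n (suc j') q) (upTo n))

-- ∏_{1 ≤ i ≤ j ≤ k ≤ n-1} [j+1]_q / [j]_q
-- (k = suc k' with k' < n-1, j = suc j' with j' < k, and one factor per i ∈ [1, j])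
prodRatio : ℕ → ℕ → ℚ
prodRatio n q =
  prodℚ (concatMap (λ k' → concatMap (λ j' →
           map (λ i' → _/_ (+ qint (suc (suc j')) q) (qint (suc j') q)
                            {{qint-suc-nonZero j' q}})
               (upTo (suc j')))
         (upTo (suc k')))
       (upTo (n ∸ 1)))

genSum : ∀ {N} → List (Subset N) → ℕ → ℕ
genSum L q = sum (map (λ I → q ^ ∣ I ∣) L)

{-# OPTIONS --safe #-}
-- In suitable coordinates (t, u, v), with u ≤ t and v ≤ n − 2 − t, each generator of T_n(S)
-- increases exactly one of u and v, so T_n(S) is the disjoint union over t of the grids
-- [0, t] × [0, n − 2 − t] with the product order.  An order ideal of such a grid is a
-- partition in a (t + 1) × (n − 1 − t) box, read off from the heights of its columns, and its
-- size is the size of the partition.  Partitions in an l × B box have generating function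
-- [l + B choose l]_q by the q-Pascal recurrence, so F(J(T_n(S)), q) is the product of the
-- [n choose t + 1]_q for t ≤ n − 2, the missing factor [n choose n]_q being 1.  The second
-- equality telescopes: for each k, ∏_{1 ≤ i ≤ j ≤ k} [j + 1]_q / [j]_q = [k + 1]_q^k / k!_q.
module Submission where

open import Algebra.Bundles using (CommutativeMonoid)
open import Data.Bool using (Bool; true; false; T)
open import Data.Empty using (⊥-elim)
open import Data.Fin.Properties using (any?)
open import Data.Fin.Subset using (Subset; ∣_∣) renaming (_∈_ to _∈ₛ_)
open import Data.Fin.Subset.Properties using (_∈?_)
open import Data.Integer using (+_)
import Data.Integer as ℤ
import Data.Integer.Properties as ℤ
open import Data.List using (List; []; _∷_; _++_; map; concatMap; foldr; applyUpTo; upTo; length; lookup)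
open import Data.List.Properties
  using (map-id-local; map-++; map-applyUpTo; map-∘; map-cong; map-cong-local; map-concatMap; concatMap-cong; ∷-injectiveˡ; ∷-injectiveʳ)
open import Data.List.Membership.Propositional using (_∈_; find; lose)
open import Data.List.Membership.Propositional.Properties
  using (∈-concatMap⁺; ∈-concatMap⁻; ∈-map⁺; ∈-map⁻; ∈-upTo⁺; ∈-upTo⁻; ∈-lookup)
open import Data.List.Relation.Binary.Disjoint.Propositional using (Disjoint)
open import Data.List.Relation.Unary.All using (All; []; _∷_)
import Data.List.Relation.Unary.All as All
open import Data.List.Relation.Unary.All.Properties using (applyUpTo⁺₂)
open import Data.List.Relation.Unary.AllPairs using ([]; _∷_)
open import Data.List.Relation.Unary.Any using (here; there; index)
open import Data.List.Relation.Unary.Any.Properties using (lookup-index)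
open import Data.List.Relation.Unary.Unique.Propositional using (Unique)
import Data.List.Relation.Unary.Unique.Propositional.Properties as UP
open import Data.List.Relation.Unary.Unique.Propositional.Properties using (Unique[x∷xs]⇒x∉xs)
open import Data.Nat using (ℕ; zero; suc; _+_; _*_; _∸_; _^_; _≤_; _<_; _<ᵇ_; z≤n; s≤s; NonZero)
open import Data.Nat.ListAction using (sum; product)
open import Data.Nat.Properties
open import Data.Nat.Tactic.RingSolver using (solve-∀)
open import Data.Product using (Σ; ∃; ∃₂; _×_; _,_; proj₁; proj₂)
open import Data.Product.Properties using (≡-dec)
open import Data.Rational using (_/_; toℚᵘ)
import Data.Rational as ℚ
open import Data.Rational.Properties using (fromℚᵘ-cong; toℚᵘ-injective; toℚᵘ-homo-*; toℚᵘ-fromℚᵘ)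
open import Data.Rational.Unnormalised using (mkℚᵘ; *≡*)
import Data.Rational.Unnormalised as ℚᵘ
import Data.Rational.Unnormalised.Properties as ℚᵘ
open import Data.Sum using (_⊎_; inj₁; inj₂)
open import Data.Unit using (tt)
open import Data.Vec using (tabulate)
import Data.Vec as Vec
open import Data.Vec.Properties using (lookup∘tabulate; tabulate∘lookup; tabulate-cong; []=⇒lookup; lookup⇒[]=)
open import Function using (_∘_; id)
open import Function.Bundles using (_⇔_; mk⇔)
open import Relation.Binary.Construct.Closure.ReflexiveTransitive using (_◅_) renaming (ε to ε★)
open import Relation.Binary.PropositionalEquality
  using (_≡_; refl; sym; trans; cong; cong₂; subst; subst₂; module ≡-Reasoning)
import Relation.Binary.PropositionalEquality as ≡
open import Relation.Nullary using (Dec; yes; no; does)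
open import Relation.Nullary.Decidable using (dec-true; dec-false; _×-dec_)

open import Defs

module BigOperator {c ℓ} (M : CommutativeMonoid c ℓ) where

  open CommutativeMonoid M renaming (refl to ≈-refl; sym to ≈-sym; trans to ≈-trans)
  open import Relation.Binary.Reasoning.Setoid setoid

  big : ℕ → (ℕ → Carrier) → Carrier
  big zero f = ε
  big (suc k) f = f 0 ∙ big k (f ∘ suc)

  cong< : ∀ k {f h : ℕ → Carrier} → (∀ i → i < k → f i ≈ h i) → big k f ≈ big k h
  cong< zero eq = ≈-refl
  cong< (suc k) eq = ∙-cong (eq 0 (s≤s z≤n)) (cong< k (λ i i<k → eq (suc i) (s≤s i<k)))

  snoc : ∀ k f → big (suc k) f ≈ big k f ∙ f k
  snoc zero f = ≈-trans (identityʳ (f 0)) (≈-sym (identityˡ (f 0)))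
  snoc (suc k) f = begin
    f 0 ∙ big (suc k) (f ∘ suc)    ≈⟨ ∙-congˡ (snoc k (f ∘ suc)) ⟩
    f 0 ∙ (big k (f ∘ suc) ∙ f (suc k)) ≈⟨ ≈-sym (assoc (f 0) _ _) ⟩
    f 0 ∙ big k (f ∘ suc) ∙ f (suc k) ∎

  ε-big : ∀ k → big k (λ _ → ε) ≈ ε
  ε-big zero = ≈-refl
  ε-big (suc k) = ≈-trans (identityˡ _) (ε-big k)

  distrib : ∀ k f h → big k (λ i → f i ∙ h i) ≈ big k f ∙ big k h
  distrib zero f h = ≈-sym (identityˡ ε)
  distrib (suc k) f h = begin
    (f 0 ∙ h 0) ∙ big k (λ i → f (suc i) ∙ h (suc i)) ≈⟨ ∙-congˡ (distrib k (f ∘ suc) (h ∘ suc)) ⟩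
    (f 0 ∙ h 0) ∙ (big k (f ∘ suc) ∙ big k (h ∘ suc)) ≈⟨ interchange (f 0) (h 0) _ _ ⟩
    (f 0 ∙ big k (f ∘ suc)) ∙ (h 0 ∙ big k (h ∘ suc))  ∎
    where open import Algebra.Properties.CommutativeSemigroup commutativeSemigroup using (interchange)

  reverse : ∀ k f → big k f ≈ big k (λ i → f (k ∸ suc i))
  reverse zero f = ≈-refl
  reverse (suc k) f = begin
    f 0 ∙ big k (f ∘ suc)                     ≈⟨ ∙-congˡ (reverse k (f ∘ suc)) ⟩
    f 0 ∙ big k (λ i → f (suc (k ∸ suc i)))  ≈⟨ comm _ _ ⟩
    big k (λ i → f (suc (k ∸ suc i))) ∙ f 0  ≈⟨ ∙-cong (cong< k (λ i i<k → reflexive (≡.cong f (≡.sym (+-∸-assoc 1 i<k)))))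
                                                        (reflexive (≡.cong f (≡.sym (n∸n≡0 k)))) ⟩
    big k (λ i → f (suc k ∸ suc i)) ∙ f (k ∸ k)   ≈⟨ ≈-sym (snoc k (λ i → f (suc k ∸ suc i))) ⟩
    big (suc k) (λ i → f (suc k ∸ suc i))    ∎

  split : ∀ k l f → big (k + l) f ≈ big k f ∙ big l (λ i → f (k + i))
  split zero l f = ≈-sym (identityˡ _)
  split (suc k) l f = ≈-trans (∙-congˡ (split k l (f ∘ suc))) (≈-sym (assoc (f 0) _ _))

  foldr-applyUpTo : ∀ k f → foldr _∙_ ε (applyUpTo f k) ≈ big k f
  foldr-applyUpTo zero f = ≈-refl
  foldr-applyUpTo (suc k) f = ∙-congˡ (foldr-applyUpTo k (f ∘ suc))

  antidiagonal : ∀ k (F : ℕ → ℕ → Carrier) →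
                 big (suc k) (λ a → F a (k ∸ a)) ≈ big (suc k) (λ c → F (k ∸ c) c)
  antidiagonal k F = ≈-trans (reverse (suc k) (λ a → F a (k ∸ a)))
    (cong< (suc k) (λ c c≤k → reflexive (≡.cong (F (k ∸ c)) (m∸[m∸n]≡n (≤-pred c≤k)))))

  -- Both sides sum F over the triangle a + c < k, the right one by antidiagonals a + c = t.
  triangle : ∀ k (F : ℕ → ℕ → Carrier) →
             big k (λ a → big (k ∸ a) (F a)) ≈ big k (λ t → big (suc t) (λ c → F (t ∸ c) c))
  triangle zero F = ≈-refl
  triangle (suc k) F = begin
    big (suc k) (λ a → big (suc k ∸ a) (F a))
      ≈⟨ cong< (suc k) (λ a a≤k → ≈-trans (reflexive (≡.cong (λ l → big l (F a)) (+-∸-assoc 1 (≤-pred a≤k))))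
                                        (snoc (k ∸ a) (F a))) ⟩
    big (suc k) (λ a → big (k ∸ a) (F a) ∙ F a (k ∸ a))
      ≈⟨ distrib (suc k) (λ a → big (k ∸ a) (F a)) (λ a → F a (k ∸ a)) ⟩
    big (suc k) (λ a → big (k ∸ a) (F a)) ∙ big (suc k) (λ a → F a (k ∸ a))
      ≈⟨ ∙-cong (snoc k _) (antidiagonal k F) ⟩
    (big k (λ a → big (k ∸ a) (F a)) ∙ big (k ∸ k) (F k)) ∙ big (suc k) (λ c → F (k ∸ c) c)
      ≈⟨ ∙-congʳ (≈-trans (∙-congˡ (reflexive (≡.cong (λ l → big l (F k)) (n∸n≡0 k)))) (identityʳ _)) ⟩
    big k (λ a → big (k ∸ a) (F a)) ∙ big (suc k) (λ c → F (k ∸ c) c)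
      ≈⟨ ∙-congʳ (triangle k F) ⟩
    big k (λ t → big (suc t) (λ c → F (t ∸ c) c)) ∙ big (suc k) (λ c → F (k ∸ c) c)
      ≈⟨ ≈-sym (snoc k _) ⟩
    big (suc k) (λ t → big (suc t) (λ c → F (t ∸ c) c)) ∎

  triangle-swap : ∀ k (F : ℕ → ℕ → Carrier) →
                  big k (λ a → big (k ∸ a) (F a)) ≈ big k (λ c → big (k ∸ c) (λ a → F a c))
  triangle-swap k F = begin
    big k (λ a → big (k ∸ a) (F a))                       ≈⟨ triangle k F ⟩
    big k (λ t → big (suc t) (λ c → F (t ∸ c) c))        ≈⟨ cong< k (λ t _ → antidiagonal t (λ c a → F a c)) ⟩
    big k (λ t → big (suc t) (λ a → F a (t ∸ a)))        ≈⟨ ≈-sym (triangle k (λ c a → F a c)) ⟩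
    big k (λ c → big (k ∸ c) (λ a → F a c))               ∎

  foldr-++ : ∀ xs ys → foldr _∙_ ε (xs ++ ys) ≈ foldr _∙_ ε xs ∙ foldr _∙_ ε ys
  foldr-++ [] ys = ≈-sym (identityˡ _)
  foldr-++ (x ∷ xs) ys = ≈-trans (∙-congˡ (foldr-++ xs ys)) (≈-sym (assoc x _ _))

  foldr-map-concatMap : ∀ {A B : Set} (f : B → Carrier) (h : A → List B) xs →
    foldr _∙_ ε (map f (concatMap h xs)) ≈ foldr _∙_ ε (map (λ x → foldr _∙_ ε (map f (h x))) xs)
  foldr-map-concatMap f h [] = ≈-refl
  foldr-map-concatMap f h (x ∷ xs) = begin
    foldr _∙_ ε (map f (h x ++ concatMap h xs))                   ≡⟨ ≡.cong (foldr _∙_ ε) (map-++ f (h x) _) ⟩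
    foldr _∙_ ε (map f (h x) ++ map f (concatMap h xs))           ≈⟨ foldr-++ (map f (h x)) _ ⟩
    foldr _∙_ ε (map f (h x)) ∙ foldr _∙_ ε (map f (concatMap h xs)) ≈⟨ ∙-congˡ (foldr-map-concatMap f h xs) ⟩
    _ ∎

open module Sum = BigOperator +-0-commutativeMonoid using () renaming (big to ∑)
open module Prod = BigOperator *-1-commutativeMonoid using () renaming (big to ∏)

sum-map-applyUpTo : ∀ {A : Set} k (f : A → ℕ) (h : ℕ → A) → sum (map f (applyUpTo h k)) ≡ ∑ k (f ∘ h)
sum-map-applyUpTo k f h = trans (cong sum (map-applyUpTo h f k)) (Sum.foldr-applyUpTo k (f ∘ h))

sum-map-upTo : ∀ k f → sum (map f (upTo k)) ≡ ∑ k f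
sum-map-upTo k f = sum-map-applyUpTo k f id

product-map-applyUpTo : ∀ {A : Set} k (f : A → ℕ) (h : ℕ → A) → product (map f (applyUpTo h k)) ≡ ∏ k (f ∘ h)
product-map-applyUpTo k f h = trans (cong product (map-applyUpTo h f k)) (Prod.foldr-applyUpTo k (f ∘ h))

product-map-upTo : ∀ k f → product (map f (upTo k)) ≡ ∏ k f
product-map-upTo k f = product-map-applyUpTo k f id

*-distribˡ-∑ : ∀ k c f → c * ∑ k f ≡ ∑ k (λ i → c * f i)
*-distribˡ-∑ zero c f = *-zeroʳ c
*-distribˡ-∑ (suc k) c f = trans (*-distribˡ-+ c (f 0) _) (cong (λ x → c * f 0 + x) (*-distribˡ-∑ k c (f ∘ suc)))

∑-mono-≤ : ∀ k {f h : ℕ → ℕ} → (∀ i → i < k → f i ≤ h i) → ∑ k f ≤ ∑ k h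
∑-mono-≤ zero le = z≤n
∑-mono-≤ (suc k) le = +-mono-≤ (le 0 (s≤s z≤n)) (∑-mono-≤ k (λ i i<k → le (suc i) (s≤s i<k)))

∑-const-1 : ∀ k → ∑ k (λ _ → 1) ≡ k
∑-const-1 zero = refl
∑-const-1 (suc k) = cong suc (∑-const-1 k)

∏-const : ∀ k c → ∏ k (λ _ → c) ≡ c ^ k
∏-const zero c = refl
∏-const (suc k) c = cong (c *_) (∏-const k c)

∏-nonZero : ∀ k (f : ℕ → ℕ) → (∀ i → NonZero (f i)) → NonZero (∏ k f)
∏-nonZero zero f nz = _
∏-nonZero (suc k) f nz = m*n≢0 (f 0) _ {{nz 0}} {{∏-nonZero k (f ∘ suc) (nz ∘ suc)}}

qint-∑ : ∀ m q → qint m q ≡ ∑ m (q ^_)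
qint-∑ m q = sum-map-upTo m (q ^_)

qint-+ : ∀ k l q → qint (k + l) q ≡ qint k q + q ^ k * qint l q
qint-+ k l q = begin
  qint (k + l) q                          ≡⟨ qint-∑ (k + l) q ⟩
  ∑ (k + l) (q ^_)                        ≡⟨ Sum.split k l (q ^_) ⟩
  ∑ k (q ^_) + ∑ l (λ i → q ^ (k + i))    ≡⟨ cong₂ _+_ (sym (qint-∑ k q)) (Sum.cong< l (λ i _ → ^-distribˡ-+-* q k i)) ⟩
  qint k q + ∑ l (λ i → q ^ k * q ^ i)    ≡⟨ cong (λ x → qint k q + x) (sym (*-distribˡ-∑ l (q ^ k) (q ^_))) ⟩
  qint k q + q ^ k * ∑ l (q ^_)           ≡⟨ cong (λ x → qint k q + q ^ k * x) (sym (qint-∑ l q)) ⟩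
  qint k q + q ^ k * qint l q             ∎
  where open ≡-Reasoning

qfact-∏ : ∀ k q → qfact k q ≡ ∏ k (λ i → qint (suc i) q)
qfact-∏ k q = product-map-upTo k (λ i → qint (suc i) q)

qfact-suc : ∀ k q → qfact (suc k) q ≡ qfact k q * qint (suc k) q
qfact-suc k q = begin
  qfact (suc k) q                             ≡⟨ qfact-∏ (suc k) q ⟩
  ∏ (suc k) (λ i → qint (suc i) q)            ≡⟨ Prod.snoc k (λ i → qint (suc i) q) ⟩
  ∏ k (λ i → qint (suc i) q) * qint (suc k) q ≡⟨ cong (_* qint (suc k) q) (sym (qfact-∏ k q)) ⟩
  qfact k q * qint (suc k) q                  ∎
  where open ≡-Reasoning

prefixWith : ∀ {A : Set} → (A → List (List A)) → List A → List (List A)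
prefixWith F = concatMap (λ x → map (x ∷_) (F x))

module _ {A : Set} (F : A → List (List A)) where

  ∈-prefixWith⁺ : ∀ {x ys xs} → x ∈ xs → ys ∈ F x → x ∷ ys ∈ prefixWith F xs
  ∈-prefixWith⁺ x∈xs ys∈Fx = ∈-concatMap⁺ (λ x → map (x ∷_) (F x)) (lose x∈xs (∈-map⁺ _ ys∈Fx))

  ∈-prefixWith⁻ : ∀ {zs} xs → zs ∈ prefixWith F xs →
                  ∃₂ λ x ys → zs ≡ x ∷ ys × x ∈ xs × ys ∈ F x
  ∈-prefixWith⁻ xs zs∈ with find (∈-concatMap⁻ (λ x → map (x ∷_) (F x)) {xs = xs} zs∈)
  ... | x , x∈xs , zs∈x∷Fx with ∈-map⁻ (x ∷_) zs∈x∷Fx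
  ...   | ys , ys∈Fx , zs≡x∷ys = x , ys , zs≡x∷ys , x∈xs , ys∈Fx

  prefixWith-unique : ∀ {xs} → Unique xs → (∀ x → Unique (F x)) → Unique (prefixWith F xs)
  prefixWith-unique [] _ = []
  prefixWith-unique {x ∷ xs} (x∉xs ∷ !xs) !F =
    UP.++⁺ (UP.map⁺ ∷-injectiveʳ (!F x)) (prefixWith-unique !xs !F) disjoint
    where
    disjoint : Disjoint (map (x ∷_) (F x)) (prefixWith F xs)
    disjoint (v∈₁ , v∈₂) with ∈-map⁻ (x ∷_) v∈₁ | ∈-prefixWith⁻ xs v∈₂
    ... | _ , _ , refl | _ , _ , eq , x′∈xs , _ =
      Unique[x∷xs]⇒x∉xs (x∉xs ∷ !xs) (subst (_∈ xs) (sym (∷-injectiveˡ eq)) x′∈xs)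

  sum-map-prefixWith : ∀ (w : List A → ℕ) xs →
    sum (map w (prefixWith F xs)) ≡ sum (map (λ x → sum (map (w ∘ (x ∷_)) (F x))) xs)
  sum-map-prefixWith w xs = trans (Sum.foldr-map-concatMap w (λ x → map (x ∷_) (F x)) xs)
    (cong sum (map-cong (λ x → cong sum (sym (map-∘ (F x)))) xs))

sum-map-*ˡ : ∀ {A : Set} c (f : A → ℕ) xs → sum (map (λ x → c * f x) xs) ≡ c * sum (map f xs)
sum-map-*ˡ c f [] = sym (*-zeroʳ c)
sum-map-*ˡ c f (x ∷ xs) = trans (cong (λ y → c * f x + y) (sum-map-*ˡ c f xs)) (sym (*-distribˡ-+ c (f x) _))

choices : ∀ {A : Set} → List (List A) → List (List A)
choices [] = [] ∷ []
choices (xs ∷ xss) = prefixWith (λ _ → choices xss) xs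

choices-unique : ∀ {A : Set} (xss : List (List A)) → All Unique xss → Unique (choices xss)
choices-unique [] [] = [] ∷ []
choices-unique (xs ∷ xss) (!xs ∷ !xss) = prefixWith-unique _ !xs (λ _ → choices-unique xss !xss)

sum-map-choices : ∀ {A : Set} q (w : A → ℕ) (xss : List (List A)) →
  sum (map (λ H → q ^ sum (map w H)) (choices xss)) ≡ product (map (λ xs → sum (map (λ x → q ^ w x) xs)) xss)
sum-map-choices q w [] = refl
sum-map-choices q w (xs ∷ xss) = begin
  sum (map (λ H → q ^ sum (map w H)) (choices (xs ∷ xss)))
    ≡⟨ sum-map-prefixWith (λ _ → choices xss) (λ H → q ^ sum (map w H)) xs ⟩
  sum (map (λ x → sum (map (λ H → q ^ (w x + sum (map w H))) (choices xss))) xs)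
    ≡⟨ cong sum (map-cong (λ x → trans (cong sum (map-cong (λ H → ^-distribˡ-+-* q (w x) _) (choices xss)))
                                       (sum-map-*ˡ (q ^ w x) _ (choices xss))) xs) ⟩
  sum (map (λ x → q ^ w x * sum (map (λ H → q ^ sum (map w H)) (choices xss))) xs)
    ≡⟨ cong sum (map-cong (λ x → cong (q ^ w x *_) (sum-map-choices q w xss)) xs) ⟩
  sum (map (λ x → q ^ w x * P) xs)
    ≡⟨ trans (cong sum (map-cong (λ x → *-comm (q ^ w x) P) xs)) (sum-map-*ˡ P (λ x → q ^ w x) xs) ⟩
  P * sum (map (λ x → q ^ w x) xs)
    ≡⟨ *-comm P _ ⟩
  sum (map (λ x → q ^ w x) xs) * P ∎
  where
  open ≡-Reasoning
  P : ℕ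
  P = product (map (λ xs → sum (map (λ x → q ^ w x) xs)) xss)

lookupOr : ∀ {A : Set} → A → List A → ℕ → A
lookupOr d [] _ = d
lookupOr d (x ∷ xs) zero = x
lookupOr d (x ∷ xs) (suc i) = lookupOr d xs i

lookupOr-applyUpTo : ∀ {A : Set} (d : A) k f i → i < k → lookupOr d (applyUpTo f k) i ≡ f i
lookupOr-applyUpTo d (suc k) f zero _ = refl
lookupOr-applyUpTo d (suc k) f (suc i) i<k = lookupOr-applyUpTo d k (f ∘ suc) i (≤-pred i<k)

applyUpTo-lookupOr : ∀ {A : Set} (d : A) xs → applyUpTo (lookupOr d xs) (length xs) ≡ xs
applyUpTo-lookupOr d [] = refl
applyUpTo-lookupOr d (x ∷ xs) = cong (x ∷_) (applyUpTo-lookupOr d xs)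

applyUpTo-cong< : ∀ {A : Set} k {f h : ℕ → A} → (∀ i → i < k → f i ≡ h i) → applyUpTo f k ≡ applyUpTo h k
applyUpTo-cong< zero eq = refl
applyUpTo-cong< (suc k) eq = cong₂ _∷_ (eq 0 (s≤s z≤n)) (applyUpTo-cong< k (λ i i<k → eq (suc i) (s≤s i<k)))

module _ {A : Set} where

  ∈-choices⁺ : ∀ k (φ : ℕ → List A) (ψ : ℕ → A) → (∀ t → t < k → ψ t ∈ φ t) →
               applyUpTo ψ k ∈ choices (applyUpTo φ k)
  ∈-choices⁺ zero φ ψ ψ∈φ = here refl
  ∈-choices⁺ (suc k) φ ψ ψ∈φ = ∈-prefixWith⁺ _ (ψ∈φ 0 (s≤s z≤n))
    (∈-choices⁺ k (φ ∘ suc) (ψ ∘ suc) (λ t t<k → ψ∈φ (suc t) (s≤s t<k)))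

  ∈-choices⁻ : ∀ (d : A) k (φ : ℕ → List A) {H} → H ∈ choices (applyUpTo φ k) →
               length H ≡ k × (∀ t → t < k → lookupOr d H t ∈ φ t)
  ∈-choices⁻ d zero φ (here refl) = refl , λ _ ()
  ∈-choices⁻ d (suc k) φ H∈ with ∈-prefixWith⁻ _ (φ 0) H∈
  ... | x , ys , refl , x∈φ0 , ys∈ with ∈-choices⁻ d k (φ ∘ suc) ys∈
  ...   | len , ∈φ = cong suc len , λ { zero _ → x∈φ0 ; (suc t) t<k → ∈φ t (≤-pred t<k) }

boxPartitions : ℕ → ℕ → List (List ℕ)
boxPartitions zero B = [] ∷ []
boxPartitions (suc l) B = prefixWith (boxPartitions l) (upTo (suc B))

boxPartitions-unique : ∀ l B → Unique (boxPartitions l B)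
boxPartitions-unique zero B = [] ∷ []
boxPartitions-unique (suc l) B = prefixWith-unique _ (UP.upTo⁺ (suc B)) (boxPartitions-unique l)

IsBoxPartition : ℕ → ℕ → List ℕ → Set
IsBoxPartition l B xs = length xs ≡ l × (∀ u → lookupOr 0 xs u ≤ B) × (∀ u → lookupOr 0 xs (suc u) ≤ lookupOr 0 xs u)

∈-boxPartitions⁻ : ∀ l B {xs} → xs ∈ boxPartitions l B → IsBoxPartition l B xs
∈-boxPartitions⁻ zero B (here refl) = refl , (λ _ → z≤n) , (λ _ → z≤n)
∈-boxPartitions⁻ (suc l) B zs∈ with ∈-prefixWith⁻ _ (upTo (suc B)) zs∈
... | x , ys , refl , x∈ , ys∈ with ∈-boxPartitions⁻ l x ys∈
...   | len , bounded , decreasing = cong suc len , bounded′ , decreasing′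
  where
  x≤B : x ≤ B
  x≤B = ≤-pred (∈-upTo⁻ x∈)
  bounded′ : ∀ u → lookupOr 0 (x ∷ ys) u ≤ B
  bounded′ zero = x≤B
  bounded′ (suc u) = ≤-trans (bounded u) x≤B
  decreasing′ : ∀ u → lookupOr 0 (x ∷ ys) (suc u) ≤ lookupOr 0 (x ∷ ys) u
  decreasing′ zero = bounded 0
  decreasing′ (suc u) = decreasing u

∈-boxPartitions⁺ : ∀ l B (f : ℕ → ℕ) → (∀ u → u < l → f u ≤ B) → (∀ u → suc u < l → f (suc u) ≤ f u) →
                   applyUpTo f l ∈ boxPartitions l B
∈-boxPartitions⁺ zero B f bounded decreasing = here refl
∈-boxPartitions⁺ (suc l) B f bounded decreasing =
  ∈-prefixWith⁺ _ (∈-upTo⁺ (s≤s (bounded 0 (s≤s z≤n))))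
    (∈-boxPartitions⁺ l (f 0) (f ∘ suc) (λ u u<l → ≤-head u (s≤s u<l)) (λ u u<l → decreasing (suc u) (s≤s u<l)))
  where
  ≤-head : ∀ u → suc u < suc l → f (suc u) ≤ f 0
  ≤-head zero u<l = decreasing 0 u<l
  ≤-head (suc u) u<l = ≤-trans (decreasing (suc u) u<l) (≤-head u (<-trans (n<1+n (suc u)) u<l))

boxGF : ℕ → ℕ → ℕ → ℕ
boxGF q l B = sum (map (λ xs → q ^ sum xs) (boxPartitions l B))

boxGF-suc : ∀ q l B → boxGF q (suc l) B ≡ ∑ (suc B) (λ x → q ^ x * boxGF q l x)
boxGF-suc q l B = begin
  boxGF q (suc l) B
    ≡⟨ sum-map-prefixWith (boxPartitions l) (λ xs → q ^ sum xs) (upTo (suc B)) ⟩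
  sum (map (λ x → sum (map (λ ys → q ^ (x + sum ys)) (boxPartitions l x))) (upTo (suc B)))
    ≡⟨ sum-map-upTo (suc B) _ ⟩
  ∑ (suc B) (λ x → sum (map (λ ys → q ^ (x + sum ys)) (boxPartitions l x)))
    ≡⟨ Sum.cong< (suc B) (λ x _ → trans (cong sum (map-cong (λ ys → ^-distribˡ-+-* q x (sum ys)) (boxPartitions l x)))
                                         (sum-map-*ˡ (q ^ x) _ (boxPartitions l x))) ⟩
  ∑ (suc B) (λ x → q ^ x * boxGF q l x) ∎
  where open ≡-Reasoning

boxGF-zeroʳ : ∀ q l → boxGF q l 0 ≡ 1
boxGF-zeroʳ q zero = refl
boxGF-zeroʳ q (suc l) = trans (boxGF-suc q l 0) (trans (+-identityʳ _) (trans (+-identityʳ _) (boxGF-zeroʳ q l)))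

boxGF-pascal : ∀ q l B → boxGF q (suc l) (suc B) ≡ boxGF q (suc l) B + q ^ suc B * boxGF q l (suc B)
boxGF-pascal q l B = begin
  boxGF q (suc l) (suc B)                                              ≡⟨ boxGF-suc q l (suc B) ⟩
  ∑ (suc (suc B)) (λ x → q ^ x * boxGF q l x)                          ≡⟨ Sum.snoc (suc B) (λ x → q ^ x * boxGF q l x) ⟩
  ∑ (suc B) (λ x → q ^ x * boxGF q l x) + q ^ suc B * boxGF q l (suc B) ≡⟨ cong (_+ q ^ suc B * boxGF q l (suc B)) (sym (boxGF-suc q l B)) ⟩
  boxGF q (suc l) B + q ^ suc B * boxGF q l (suc B)                    ∎
  where open ≡-Reasoning

boxGF-qbinomial : ∀ q l B → boxGF q l B * (qfact l q * qfact B q) ≡ qfact (l + B) q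
boxGF-qbinomial q zero B = trans (+-identityʳ _) (*-identityˡ _)
boxGF-qbinomial q (suc l) zero = begin
  boxGF q (suc l) 0 * (qfact (suc l) q * 1) ≡⟨ cong₂ _*_ (boxGF-zeroʳ q (suc l)) (*-identityʳ _) ⟩
  1 * qfact (suc l) q                       ≡⟨ *-identityˡ _ ⟩
  qfact (suc l) q                           ≡⟨ cong (λ k → qfact k q) (sym (+-identityʳ (suc l))) ⟩
  qfact (suc l + 0) q                       ∎
  where open ≡-Reasoning
boxGF-qbinomial q (suc l) (suc B) = begin
  boxGF q (suc l) (suc B) * (qfact (suc l) q * qfact (suc B) q)
    ≡⟨ cong₂ _*_ (boxGF-pascal q l B) (cong₂ _*_ (qfact-suc l q) (qfact-suc B q)) ⟩
  (X + p * Y) * ((l! * [l+1]) * (B! * [B+1]))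
    ≡⟨ regroup X Y l! B! [l+1] [B+1] p ⟩
  X * ((l! * [l+1]) * B!) * [B+1] + p * ((Y * (l! * (B! * [B+1]))) * [l+1])
    ≡⟨ cong₂ (λ u v → u * [B+1] + p * (v * [l+1]))
         (trans (cong (λ k → X * (k * B!)) (sym (qfact-suc l q))) (boxGF-qbinomial q (suc l) B))
         (trans (cong (λ k → Y * (l! * k)) (sym (qfact-suc B q))) (boxGF-qbinomial q l (suc B))) ⟩
  qfact (suc l + B) q * [B+1] + p * (qfact (l + suc B) q * [l+1])
    ≡⟨ cong (λ k → qfact (suc l + B) q * [B+1] + p * (qfact k q * [l+1])) (+-suc l B) ⟩
  Z * [B+1] + p * (Z * [l+1])
    ≡⟨ factor Z [B+1] p [l+1] ⟩
  Z * ([B+1] + p * [l+1])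
    ≡⟨ cong (Z *_) (sym (qint-+ (suc B) (suc l) q)) ⟩
  Z * qint (suc B + suc l) q
    ≡⟨ cong (λ k → Z * qint k q) (cong suc (trans (+-suc B l) (cong suc (+-comm B l)))) ⟩
  Z * qint (suc (suc (l + B))) q
    ≡⟨ sym (qfact-suc (suc (l + B)) q) ⟩
  qfact (suc (suc (l + B))) q
    ≡⟨ cong (λ k → qfact (suc k) q) (sym (+-suc l B)) ⟩
  qfact (suc l + suc B) q ∎
  where
  open ≡-Reasoning
  X Y p l! B! [l+1] [B+1] Z : ℕ
  X = boxGF q (suc l) B
  Y = boxGF q l (suc B)
  p = q ^ suc B
  l! = qfact l q
  B! = qfact B q
  [l+1] = qint (suc l) q
  [B+1] = qint (suc B) q
  Z = qfact (suc (l + B)) q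
  regroup : ∀ X Y l! B! [l+1] [B+1] p → (X + p * Y) * ((l! * [l+1]) * (B! * [B+1])) ≡
            X * ((l! * [l+1]) * B!) * [B+1] + p * ((Y * (l! * (B! * [B+1]))) * [l+1])
  regroup = solve-∀
  factor : ∀ Z a p c → Z * a + p * (Z * c) ≡ Z * (a + p * c)
  factor = solve-∀

/-cross : ∀ a k c l .{{_ : NonZero k}} .{{_ : NonZero l}} → a * l ≡ c * k → + a / k ≡ + c / l
/-cross a (suc k) c (suc l) eq = fromℚᵘ-cong {mkℚᵘ (+ a) k} {mkℚᵘ (+ c) l}
  (*≡* (trans (sym (ℤ.pos-* a (suc l))) (trans (cong +_ eq) (ℤ.pos-* c (suc k)))))

/-*-/ : ∀ a k c l .{{_ : NonZero k}} .{{_ : NonZero l}} .{{_ : NonZero (k * l)}} →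
        (+ a / k) ℚ.* (+ c / l) ≡ + (a * c) / (k * l)
/-*-/ a (suc k) c (suc l) = toℚᵘ-injective (begin
  toℚᵘ ((+ a / suc k) ℚ.* (+ c / suc l))          ≈⟨ toℚᵘ-homo-* (+ a / suc k) (+ c / suc l) ⟩
  toℚᵘ (+ a / suc k) ℚᵘ.* toℚᵘ (+ c / suc l)      ≈⟨ ℚᵘ.*-cong (toℚᵘ-fromℚᵘ (mkℚᵘ (+ a) k)) (toℚᵘ-fromℚᵘ (mkℚᵘ (+ c) l)) ⟩
  mkℚᵘ (+ a) k ℚᵘ.* mkℚᵘ (+ c) l                  ≈⟨ *≡* (cong₂ ℤ._*_ (sym (ℤ.pos-* a c)) refl) ⟩
  mkℚᵘ (+ (a * c)) (l + k * suc l)                 ≈⟨ ℚᵘ.≃-sym (toℚᵘ-fromℚᵘ (mkℚᵘ (+ (a * c)) (l + k * suc l))) ⟩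
  toℚᵘ (+ (a * c) / (suc k * suc l))               ∎)
  where open ℚᵘ.≃-Reasoning

product-map-nonZero : ∀ {A : Set} (f : A → ℕ) → (∀ x → NonZero (f x)) → ∀ xs → NonZero (product (map f xs))
product-map-nonZero f nz [] = _
product-map-nonZero f nz (x ∷ xs) = m*n≢0 (f x) _ {{nz x}} {{product-map-nonZero f nz xs}}

prodℚ-map-/ : ∀ {A : Set} (f d : A → ℕ) (nz : ∀ x → NonZero (d x)) xs →
  prodℚ (map (λ x → _/_ (+ f x) (d x) {{nz x}}) xs) ≡
  _/_ (+ product (map f xs)) (product (map d xs)) {{product-map-nonZero d nz xs}}
prodℚ-map-/ f d nz [] = refl
prodℚ-map-/ f d nz (x ∷ xs) = trans
  (cong (_/_ (+ f x) (d x) {{nz x}} ℚ.*_) (prodℚ-map-/ f d nz xs))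
  (/-*-/ (f x) (d x) (product (map f xs)) (product (map d xs))
         {{nz x}} {{product-map-nonZero d nz xs}} {{product-map-nonZero d nz (x ∷ xs)}})

^-distribʳ-* : ∀ a c k → (a * c) ^ k ≡ a ^ k * c ^ k
^-distribʳ-* a c zero = refl
^-distribʳ-* a c (suc k) = trans (cong (a * c *_) (^-distribʳ-* a c k)) (shuffle a c (a ^ k) (c ^ k))
  where shuffle : ∀ a c x z → a * c * (x * z) ≡ a * x * (c * z)
        shuffle = solve-∀

qsuperfact : ℕ → ℕ → ℕ
qsuperfact k q = ∏ k (λ j → qfact (suc j) q)

qsuperfact-nonZero : ∀ k q → NonZero (qsuperfact k q)
qsuperfact-nonZero k q = ∏-nonZero k _ (λ j → qfact-nonZero (suc j) q)

-- The index j of each factor [j + 2]_q / [j + 1]_q of prodRatio, in the order of its concatMap.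
repeatIndex : ℕ → List ℕ
repeatIndex j = map (λ _ → j) (upTo (suc j))

ratioIndicesUpTo : ℕ → List ℕ
ratioIndicesUpTo i = concatMap repeatIndex (upTo (suc i))

ratioIndices : ℕ → List ℕ
ratioIndices k = concatMap ratioIndicesUpTo (upTo k)

map-ratioIndices : ∀ {A : Set} (φ : ℕ → A) k →
  map φ (ratioIndices k) ≡ concatMap (λ i → concatMap (λ j → map (λ _ → φ j) (upTo (suc j))) (upTo (suc i))) (upTo k)
map-ratioIndices φ k = begin
  map φ (ratioIndices k)
    ≡⟨ map-concatMap φ ratioIndicesUpTo (upTo k) ⟩
  concatMap (λ i → map φ (ratioIndicesUpTo i)) (upTo k)
    ≡⟨ concatMap-cong (λ i → trans (map-concatMap φ repeatIndex (upTo (suc i)))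
                                  (concatMap-cong (λ j → sym (map-∘ {g = φ} {f = λ _ → j} (upTo (suc j)))) (upTo (suc i)))) (upTo k) ⟩
  concatMap (λ i → concatMap (λ j → map (λ _ → φ j) (upTo (suc j))) (upTo (suc i))) (upTo k) ∎
  where open ≡-Reasoning

product-map-ratioIndices : ∀ (f : ℕ → ℕ) k → product (map f (ratioIndices k)) ≡ ∏ k (λ i → ∏ (suc i) (λ j → f j ^ suc j))
product-map-ratioIndices f k = begin
  product (map f (ratioIndices k))
    ≡⟨ Prod.foldr-map-concatMap f ratioIndicesUpTo (upTo k) ⟩
  product (map (λ i → product (map f (ratioIndicesUpTo i))) (upTo k))
    ≡⟨ product-map-upTo k (λ i → product (map f (ratioIndicesUpTo i))) ⟩
  ∏ k (λ i → product (map f (ratioIndicesUpTo i)))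
    ≡⟨ Prod.cong< k (λ i _ → trans (Prod.foldr-map-concatMap f repeatIndex (upTo (suc i)))
                             (trans (product-map-upTo (suc i) (λ j → product (map f (repeatIndex j))))
                                    (Prod.cong< (suc i) (λ j _ → product-map-repeatIndex j)))) ⟩
  ∏ k (λ i → ∏ (suc i) (λ j → f j ^ suc j)) ∎
  where
  open ≡-Reasoning
  product-map-repeatIndex : ∀ j → product (map f (repeatIndex j)) ≡ f j ^ suc j
  product-map-repeatIndex j = trans (cong product (sym (map-∘ {g = f} {f = λ _ → j} (upTo (suc j)))))
                                    (trans (product-map-upTo (suc j) (λ _ → f j)) (∏-const (suc j) (f j)))

module _ (q : ℕ) where
  private
    [_] : ℕ → ℕ
    [ k ] = qint k q
    _! : ℕ → ℕ
    k ! = qfact k q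

  qfact-^-self : ∀ k → (k !) ^ k ≡ ∏ k (λ j → [ suc j ] ^ j) * qsuperfact k q
  qfact-^-self zero = refl
  qfact-^-self (suc k) = begin
    (suc k !) ^ suc k                                 ≡⟨ cong (_^ suc k) (qfact-suc k q) ⟩
    (k ! * [ suc k ]) ^ suc k                         ≡⟨ ^-distribʳ-* (k !) [ suc k ] (suc k) ⟩
    k ! * (k !) ^ k * ([ suc k ] * [ suc k ] ^ k)      ≡⟨ cong (λ x → k ! * x * ([ suc k ] * [ suc k ] ^ k)) (qfact-^-self k) ⟩
    k ! * (R * qsuperfact k q) * ([ suc k ] * [ suc k ] ^ k)
      ≡⟨ shuffle R (qsuperfact k q) (k !) [ suc k ] ([ suc k ] ^ k) ⟩
    R * [ suc k ] ^ k * (qsuperfact k q * (k ! * [ suc k ]))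
      ≡⟨ cong₂ _*_ (sym (Prod.snoc k (λ j → [ suc j ] ^ j))) (cong (qsuperfact k q *_) (sym (qfact-suc k q))) ⟩
    ∏ (suc k) (λ j → [ suc j ] ^ j) * (qsuperfact k q * suc k !)
      ≡⟨ cong (∏ (suc k) (λ j → [ suc j ] ^ j) *_) (sym (Prod.snoc k (λ j → suc j !))) ⟩
    ∏ (suc k) (λ j → [ suc j ] ^ j) * qsuperfact (suc k) q ∎
    where
    open ≡-Reasoning
    R : ℕ
    R = ∏ k (λ j → [ suc j ] ^ j)
    shuffle : ∀ r s f i p → f * (r * s) * (i * p) ≡ r * p * (s * (f * i))
    shuffle = solve-∀

  -- ∏_{j=1}^{k} ([j + 1]_q / [j]_q)^j = [k + 1]_q^k / k!_q, with denominators cleared.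
  telescope : ∀ k → ∏ k (λ j → [ suc (suc j) ] ^ suc j) * k ! ≡ [ suc k ] ^ k * ∏ k (λ j → [ suc j ] ^ suc j)
  telescope zero = refl
  telescope (suc k) = begin
    ∏ (suc k) (λ j → [ suc (suc j) ] ^ suc j) * suc k !
      ≡⟨ cong₂ _*_ (Prod.snoc k (λ j → [ suc (suc j) ] ^ suc j)) (qfact-suc k q) ⟩
    ∏ k (λ j → [ suc (suc j) ] ^ suc j) * A * (k ! * [ suc k ])
      ≡⟨ shuffle₁ (∏ k (λ j → [ suc (suc j) ] ^ suc j)) A (k !) [ suc k ] ⟩
    ∏ k (λ j → [ suc (suc j) ] ^ suc j) * k ! * A * [ suc k ]
      ≡⟨ cong (λ x → x * A * [ suc k ]) (telescope k) ⟩
    [ suc k ] ^ k * D * A * [ suc k ]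
      ≡⟨ shuffle₂ ([ suc k ] ^ k) D A [ suc k ] ⟩
    A * (D * [ suc k ] ^ suc k)
      ≡⟨ cong (A *_) (sym (Prod.snoc k (λ j → [ suc j ] ^ suc j))) ⟩
    A * ∏ (suc k) (λ j → [ suc j ] ^ suc j) ∎
    where
    open ≡-Reasoning
    A D : ℕ
    A = [ suc (suc k) ] ^ suc k
    D = ∏ k (λ j → [ suc j ] ^ suc j)
    shuffle₁ : ∀ x a f i → x * a * (f * i) ≡ x * f * a * i
    shuffle₁ = solve-∀
    shuffle₂ : ∀ x d a i → x * d * a * i ≡ a * (d * (i * x))
    shuffle₂ = solve-∀

  binomialDenominator : ℕ → ℕ → ℕ
  binomialDenominator k j = suc j ! * (k ∸ j) !

  binomialDenominator-nonZero : ∀ k j → NonZero (binomialDenominator k j)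
  binomialDenominator-nonZero k j = m*n≢0 (suc j !) ((k ∸ j) !) {{qfact-nonZero (suc j) q}} {{qfact-nonZero (k ∸ j) q}}

  qsuperfact²-nonZero : ∀ k → NonZero (qsuperfact (suc k) q * qsuperfact k q)
  qsuperfact²-nonZero k = m*n≢0 _ _ {{qsuperfact-nonZero (suc k) q}} {{qsuperfact-nonZero k q}}

  ratioNumerator ratioDenominator : ℕ → ℕ
  ratioNumerator k = ∏ k (λ i → ∏ (suc i) (λ j → [ suc (suc j) ] ^ suc j))
  ratioDenominator k = ∏ k (λ i → ∏ (suc i) (λ j → [ suc j ] ^ suc j))

  ratioDenominator-nonZero : ∀ k → NonZero (ratioDenominator k)
  ratioDenominator-nonZero k = ∏-nonZero k _ (λ i → ∏-nonZero (suc i) _ (λ j → m^n≢0 [ suc j ] (suc j) {{qint-suc-nonZero j q}}))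

  ∏-binomialDenominator : ∀ k → ∏ (suc k) (binomialDenominator k) ≡ qsuperfact (suc k) q * qsuperfact k q
  ∏-binomialDenominator k = begin
    ∏ (suc k) (binomialDenominator k)                     ≡⟨ Prod.distrib (suc k) (λ j → suc j !) (λ j → (k ∸ j) !) ⟩
    qsuperfact (suc k) q * ∏ (suc k) (λ j → (k ∸ j) !)   ≡⟨ cong (qsuperfact (suc k) q *_) (sym (Prod.reverse (suc k) _!)) ⟩
    qsuperfact (suc k) q * (1 * qsuperfact k q)           ≡⟨ cong (qsuperfact (suc k) q *_) (*-identityˡ _) ⟩
    qsuperfact (suc k) q * qsuperfact k q                 ∎
    where open ≡-Reasoning

  prodBinom-as-fraction : ∀ k → prodBinom (suc k) q ≡
                  _/_ (+ (suc k ! ^ suc k)) (qsuperfact (suc k) q * qsuperfact k q) {{qsuperfact²-nonZero k}}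
  prodBinom-as-fraction k = trans
    (prodℚ-map-/ (λ _ → suc k !) (binomialDenominator k) (binomialDenominator-nonZero k) (upTo (suc k)))
    (/-cross (product (map (λ _ → suc k !) (upTo (suc k)))) (product (map (binomialDenominator k) (upTo (suc k))))
             (suc k ! ^ suc k) (qsuperfact (suc k) q * qsuperfact k q)
             {{product-map-nonZero _ (binomialDenominator-nonZero k) (upTo (suc k))}} {{qsuperfact²-nonZero k}}
       (cong₂ _*_ (trans (product-map-upTo (suc k) (λ _ → suc k !)) (∏-const (suc k) (suc k !)))
                  (sym (trans (product-map-upTo (suc k) (binomialDenominator k)) (∏-binomialDenominator k)))))

  prodRatio-as-fraction : ∀ k → prodRatio (suc k) q ≡ _/_ (+ ratioNumerator k) (ratioDenominator k) {{ratioDenominator-nonZero k}}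
  prodRatio-as-fraction k = begin
    prodRatio (suc k) q
      ≡⟨ cong prodℚ (sym (map-ratioIndices ratio k)) ⟩
    prodℚ (map ratio (ratioIndices k))
      ≡⟨ prodℚ-map-/ (λ j → [ suc (suc j) ]) (λ j → [ suc j ]) (λ j → qint-suc-nonZero j q) (ratioIndices k) ⟩
    _/_ (+ product (map (λ j → [ suc (suc j) ]) (ratioIndices k))) (product (map (λ j → [ suc j ]) (ratioIndices k)))
        {{product-map-nonZero _ (λ j → qint-suc-nonZero j q) (ratioIndices k)}}
      ≡⟨ /-cross (product (map (λ j → [ suc (suc j) ]) (ratioIndices k))) (product (map (λ j → [ suc j ]) (ratioIndices k)))
                 (ratioNumerator k) (ratioDenominator k)
                 {{product-map-nonZero _ (λ j → qint-suc-nonZero j q) (ratioIndices k)}} {{ratioDenominator-nonZero k}}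
           (cong₂ _*_ (product-map-ratioIndices (λ j → [ suc (suc j) ]) k)
                      (sym (product-map-ratioIndices (λ j → [ suc j ]) k))) ⟩
    _/_ (+ ratioNumerator k) (ratioDenominator k) {{ratioDenominator-nonZero k}} ∎
    where
    open ≡-Reasoning
    ratio : ℕ → ℚ.ℚ
    ratio j = _/_ (+ [ suc (suc j) ]) [ suc j ] {{qint-suc-nonZero j q}}

  ratioNumerator-telescope : ∀ k → ratioNumerator k * qsuperfact k q ≡ ∏ k (λ j → [ suc (suc j) ] ^ suc j) * ratioDenominator k
  ratioNumerator-telescope k = begin
    ratioNumerator k * qsuperfact k q
      ≡⟨ sym (Prod.distrib k _ (λ i → suc i !)) ⟩
    ∏ k (λ i → ∏ (suc i) (λ j → [ suc (suc j) ] ^ suc j) * suc i !)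
      ≡⟨ Prod.cong< k (λ i _ → telescope (suc i)) ⟩
    ∏ k (λ i → [ suc (suc i) ] ^ suc i * ∏ (suc i) (λ j → [ suc j ] ^ suc j))
      ≡⟨ Prod.distrib k _ _ ⟩
    ∏ k (λ j → [ suc (suc j) ] ^ suc j) * ratioDenominator k ∎
    where open ≡-Reasoning

  prodBinom≡prodRatio : ∀ n → prodBinom n q ≡ prodRatio n q
  prodBinom≡prodRatio zero = refl
  prodBinom≡prodRatio (suc k) = begin
    prodBinom (suc k) q
      ≡⟨ prodBinom-as-fraction k ⟩
    _/_ (+ (suc k ! ^ suc k)) (qsuperfact (suc k) q * qsuperfact k q) {{qsuperfact²-nonZero k}}
      ≡⟨ /-cross (suc k ! ^ suc k) (qsuperfact (suc k) q * qsuperfact k q) (ratioNumerator k) (ratioDenominator k)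
                 {{qsuperfact²-nonZero k}} {{ratioDenominator-nonZero k}} cross ⟩
    _/_ (+ ratioNumerator k) (ratioDenominator k) {{ratioDenominator-nonZero k}}
      ≡⟨ sym (prodRatio-as-fraction k) ⟩
    prodRatio (suc k) q ∎
    where
    open ≡-Reasoning
    R : ℕ
    R = ∏ k (λ j → [ suc (suc j) ] ^ suc j)
    cross : suc k ! ^ suc k * ratioDenominator k ≡ ratioNumerator k * (qsuperfact (suc k) q * qsuperfact k q)
    cross = begin
      suc k ! ^ suc k * ratioDenominator k                        ≡⟨ cong (_* ratioDenominator k) (qfact-^-self (suc k)) ⟩
      1 * R * qsuperfact (suc k) q * ratioDenominator k            ≡⟨ shuffle R (qsuperfact (suc k) q) (ratioDenominator k) ⟩
      R * ratioDenominator k * qsuperfact (suc k) q                ≡⟨ cong (_* qsuperfact (suc k) q) (sym (ratioNumerator-telescope k)) ⟩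
      ratioNumerator k * qsuperfact k q * qsuperfact (suc k) q     ≡⟨ *-assoc (ratioNumerator k) _ _ ⟩
      ratioNumerator k * (qsuperfact k q * qsuperfact (suc k) q)   ≡⟨ cong (ratioNumerator k *_) (*-comm (qsuperfact k q) _) ⟩
      ratioNumerator k * (qsuperfact (suc k) q * qsuperfact k q)   ∎
      where shuffle : ∀ r s d → 1 * r * s * d ≡ r * d * s
            shuffle = solve-∀

  -- Block t contributes [k + 1 choose t + 1]_q; the factor [k + 1 choose k + 1]_q = 1 is absent.
  ∏boxGF≡prodBinom : ∀ k → + ∏ k (λ t → boxGF q (suc t) (k ∸ t)) / 1 ≡ prodBinom (suc k) q
  ∏boxGF≡prodBinom k = trans
    (/-cross (∏ k G) 1 (suc k ! ^ suc k) (qsuperfact (suc k) q * qsuperfact k q) {{_}} {{qsuperfact²-nonZero k}} cross)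
    (sym (prodBinom-as-fraction k))
    where
    open ≡-Reasoning
    G : ℕ → ℕ
    G t = boxGF q (suc t) (k ∸ t)
    box : ∀ t → t < k → G t * binomialDenominator k t ≡ suc k !
    box t t<k = trans (boxGF-qbinomial q (suc t) (k ∸ t))
                      (cong (λ l → suc l !) (m+[n∸m]≡n (<⇒≤ t<k)))
    cross : ∏ k G * (qsuperfact (suc k) q * qsuperfact k q) ≡ suc k ! ^ suc k * 1
    cross = begin
      ∏ k G * (qsuperfact (suc k) q * qsuperfact k q)
        ≡⟨ cong (∏ k G *_) (trans (sym (∏-binomialDenominator k)) (Prod.snoc k (binomialDenominator k))) ⟩
      ∏ k G * (∏ k (binomialDenominator k) * binomialDenominator k k)
        ≡⟨ sym (*-assoc (∏ k G) _ _) ⟩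
      ∏ k G * ∏ k (binomialDenominator k) * binomialDenominator k k
        ≡⟨ cong (_* binomialDenominator k k) (sym (Prod.distrib k G (binomialDenominator k))) ⟩
      ∏ k (λ t → G t * binomialDenominator k t) * binomialDenominator k k
        ≡⟨ cong₂ _*_ (Prod.cong< k box) (cong (λ l → suc k ! * l !) (n∸n≡0 k)) ⟩
      ∏ k (λ _ → suc k !) * (suc k ! * 1)
        ≡⟨ cong₂ _*_ (∏-const k (suc k !)) (*-identityʳ _) ⟩
      suc k ! ^ k * suc k !
        ≡⟨ *-comm (suc k ! ^ k) _ ⟩
      suc k ! ^ suc k
        ≡⟨ sym (*-identityʳ _) ⟩
      suc k ! ^ suc k * 1 ∎

module _ (n : ℕ) where
  private
    m : ℕ
    m = n ∸ 2
    column : ℕ → ℕ → List Pt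
    column a₁ a₂ = map (λ a₃ → a₁ , a₂ , a₃) (upTo (suc (m ∸ a₁ ∸ a₂)))
    slice : ℕ → List Pt
    slice a₁ = concatMap (column a₁) (upTo (suc (m ∸ a₁)))

  InT⇒∈ptsT : ∀ {p} → InT n p → p ∈ ptsT n
  InT⇒∈ptsT {a₁ , a₂ , a₃} p∈T = ∈-concatMap⁺ slice (lose (∈-upTo⁺ (s≤s a₁≤))
      (∈-concatMap⁺ (column a₁) (lose (∈-upTo⁺ (s≤s a₂≤)) (∈-map⁺ (λ a₃ → a₁ , a₂ , a₃) (∈-upTo⁺ (s≤s a₃≤))))))
    where
    a₁≤ : a₁ ≤ m
    a₁≤ = m+n≤o⇒m≤o a₁ (m+n≤o⇒m≤o (a₁ + a₂) p∈T)
    a₂≤ : a₂ ≤ m ∸ a₁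
    a₂≤ = m+n≤o⇒m≤o∸n a₂ (subst (_≤ m) (+-comm a₁ a₂) (m+n≤o⇒m≤o (a₁ + a₂) p∈T))
    a₃≤ : a₃ ≤ m ∸ a₁ ∸ a₂
    a₃≤ = subst (a₃ ≤_) (sym (∸-+-assoc m a₁ a₂)) (m+n≤o⇒m≤o∸n a₃ (subst (_≤ m) (+-comm (a₁ + a₂) a₃) p∈T))

  ∈ptsT⇒InT : ∀ {p} → p ∈ ptsT n → InT n p
  ∈ptsT⇒InT p∈ with find (∈-concatMap⁻ slice {xs = upTo (suc m)} p∈)
  ... | a₁ , a₁∈ , p∈slice with find (∈-concatMap⁻ (column a₁) {xs = upTo (suc (m ∸ a₁))} p∈slice)
  ...   | a₂ , a₂∈ , p∈column with ∈-map⁻ (λ a₃ → a₁ , a₂ , a₃) p∈column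
  ...     | a₃ , a₃∈ , refl = begin
    a₁ + a₂ + a₃              ≡⟨ +-assoc a₁ a₂ a₃ ⟩
    a₁ + (a₂ + a₃)            ≤⟨ +-monoʳ-≤ a₁ (a₂+a₃≤m∸a₁ (≤-pred (∈-upTo⁻ a₂∈)) (≤-pred (∈-upTo⁻ a₃∈))) ⟩
    a₁ + (m ∸ a₁)             ≡⟨ m+[n∸m]≡n (≤-pred (∈-upTo⁻ a₁∈)) ⟩
    m                         ∎
    where
    open ≤-Reasoning
    a₂+a₃≤m∸a₁ : a₂ ≤ m ∸ a₁ → a₃ ≤ m ∸ a₁ ∸ a₂ → a₂ + a₃ ≤ m ∸ a₁
    a₂+a₃≤m∸a₁ a₂≤ a₃≤ = subst (_≤ m ∸ a₁) (+-comm a₃ a₂) (m≤o∸n⇒m+n≤o a₃ a₂≤ a₃≤)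

  elt-InT : ∀ i → InT n (elt n i)
  elt-InT i = ∈ptsT⇒InT (∈-lookup i)

  InT⇒elt : ∀ {p} → InT n p → ∃ λ i → elt n i ≡ p
  InT⇒elt p∈T = index p∈ , sym (lookup-index p∈)
    where p∈ = InT⇒∈ptsT p∈T

  sum-map-ptsT : ∀ (f : Pt → ℕ) → sum (map f (ptsT n)) ≡
    ∑ (suc m) (λ a₁ → ∑ (suc (m ∸ a₁)) (λ a₂ → ∑ (suc (m ∸ a₁ ∸ a₂)) (λ a₃ → f (a₁ , a₂ , a₃))))
  sum-map-ptsT f = begin
    sum (map f (ptsT n))
      ≡⟨ Sum.foldr-map-concatMap f slice (upTo (suc m)) ⟩
    sum (map (λ a₁ → sum (map f (slice a₁))) (upTo (suc m)))
      ≡⟨ sum-map-upTo (suc m) _ ⟩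
    ∑ (suc m) (λ a₁ → sum (map f (slice a₁)))
      ≡⟨ Sum.cong< (suc m) (λ a₁ _ → trans (Sum.foldr-map-concatMap f (column a₁) (upTo (suc (m ∸ a₁))))
           (trans (sum-map-upTo (suc (m ∸ a₁)) _) (Sum.cong< (suc (m ∸ a₁)) (λ a₂ _ →
              trans (cong sum (sym (map-∘ {g = f} {f = λ a₃ → a₁ , a₂ , a₃} (upTo (suc (m ∸ a₁ ∸ a₂))))))
                    (sum-map-upTo (suc (m ∸ a₁ ∸ a₂)) (λ a₃ → f (a₁ , a₂ , a₃))))))) ⟩
    ∑ (suc m) (λ a₁ → ∑ (suc (m ∸ a₁)) (λ a₂ → ∑ (suc (m ∸ a₁ ∸ a₂)) (λ a₃ → f (a₁ , a₂ , a₃)))) ∎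
    where open ≡-Reasoning

<ᵇ-true : ∀ {m n} → m < n → (m <ᵇ n) ≡ true
<ᵇ-true {m} {n} = dec-true (m <? n)

<ᵇ-false : ∀ {m n} → n ≤ m → (m <ᵇ n) ≡ false
<ᵇ-false {m} {n} n≤m = dec-false (m <? n) (≤⇒≯ n≤m)

<ᵇ-true⁻ : ∀ {m n} → (m <ᵇ n) ≡ true → m < n
<ᵇ-true⁻ {m} {n} eq = <ᵇ⇒< m n (subst T (sym eq) tt)

does-≡ : ∀ {A : Set} (A? : Dec A) {b : Bool} → (A → b ≡ true) → (b ≡ true → A) → does A? ≡ b
does-≡ (yes a) to from = sym (to a)
does-≡ (no _) {false} to from = refl
does-≡ (no ¬a) {true} to from = ⊥-elim (¬a (from refl))

does-true⁻ : ∀ {A : Set} (A? : Dec A) → does A? ≡ true → A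
does-true⁻ (yes a) _ = a

𝟙 : Bool → ℕ
𝟙 true = 1
𝟙 false = 0

∑𝟙≤ : ∀ K (P : ℕ → Bool) → ∑ K (𝟙 ∘ P) ≤ K
∑𝟙≤ zero P = z≤n
∑𝟙≤ (suc K) P with P 0
... | true = s≤s (∑𝟙≤ K (P ∘ suc))
... | false = m≤n⇒m≤1+n (∑𝟙≤ K (P ∘ suc))

∑𝟙-true : ∀ K (P : ℕ → Bool) → (∀ w → w < K → P w ≡ true) → ∑ K (𝟙 ∘ P) ≡ K
∑𝟙-true K P all = trans (Sum.cong< K (λ w w<K → cong 𝟙 (all w w<K))) (∑-const-1 K)

∑𝟙-<ᵇ : ∀ K h → h ≤ K → ∑ K (λ v → 𝟙 (v <ᵇ h)) ≡ h
∑𝟙-<ᵇ K zero _ = Sum.ε-big K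
∑𝟙-<ᵇ (suc K) (suc h) (s≤s h≤K) = cong suc (∑𝟙-<ᵇ K h h≤K)

∑𝟙-snoc-false : ∀ K (P : ℕ → Bool) → P K ≡ false → ∑ (suc K) (𝟙 ∘ P) ≡ ∑ K (𝟙 ∘ P)
∑𝟙-snoc-false K P PK = trans (Sum.snoc K (𝟙 ∘ P)) (trans (cong (λ b → ∑ K (𝟙 ∘ P) + 𝟙 b) PK) (+-identityʳ _))

DownClosed : ℕ → (ℕ → Bool) → Set
DownClosed K P = ∀ v → suc v < K → P (suc v) ≡ true → P v ≡ true

downClosed-≤ : ∀ {K P} → DownClosed K P → ∀ j w → w + j < K → P (w + j) ≡ true → P w ≡ true
downClosed-≤ {P = P} _ zero w _ Pw = subst (λ x → P x ≡ true) (+-identityʳ w) Pw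
downClosed-≤ {K} {P} dc (suc j) w w+j<K Pw+j = downClosed-≤ dc j w (<-trans (n<1+n (w + j)) lt)
  (dc (w + j) lt (subst (λ x → P x ≡ true) (+-suc w j) Pw+j))
  where lt = subst (_< K) (+-suc w j) w+j<K

downClosed⇒threshold : ∀ K (P : ℕ → Bool) → DownClosed K P → ∀ v → v < K → P v ≡ (v <ᵇ ∑ K (𝟙 ∘ P))
downClosed⇒threshold (suc K) P dc v v≤K with P K in PK | m≤n⇒m<n∨m≡n (≤-pred v≤K)
... | true | _ = begin
  P v                       ≡⟨ all v v≤K ⟩
  true                      ≡⟨ sym (<ᵇ-true v≤K) ⟩
  v <ᵇ suc K                ≡⟨ cong (v <ᵇ_) (sym (∑𝟙-true (suc K) P all)) ⟩
  v <ᵇ ∑ (suc K) (𝟙 ∘ P)   ∎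
  where
  open ≡-Reasoning
  all : ∀ w → w < suc K → P w ≡ true
  all w w≤K = downClosed-≤ dc (K ∸ w) w (subst (_< suc K) (sym (m+[n∸m]≡n (≤-pred w≤K))) (n<1+n K))
                (subst (λ x → P x ≡ true) (sym (m+[n∸m]≡n (≤-pred w≤K))) PK)
... | false | inj₁ v<K = begin
  P v                       ≡⟨ downClosed⇒threshold K P (λ w w<K → dc w (m≤n⇒m≤1+n w<K)) v v<K ⟩
  v <ᵇ ∑ K (𝟙 ∘ P)         ≡⟨ cong (v <ᵇ_) (sym count) ⟩
  v <ᵇ ∑ (suc K) (𝟙 ∘ P)   ∎
  where
  open ≡-Reasoning
  count : ∑ (suc K) (𝟙 ∘ P) ≡ ∑ K (𝟙 ∘ P)
  count = ∑𝟙-snoc-false K P PK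
... | false | inj₂ refl = begin
  P v                       ≡⟨ PK ⟩
  false                     ≡⟨ sym (<ᵇ-false (≤-trans (≤-reflexive count) (∑𝟙≤ v P))) ⟩
  v <ᵇ ∑ (suc v) (𝟙 ∘ P)   ∎
  where
  open ≡-Reasoning
  count : ∑ (suc v) (𝟙 ∘ P) ≡ ∑ v (𝟙 ∘ P)
  count = ∑𝟙-snoc-false v P PK

∣tabulate∣ : ∀ {A : Set} (xs : List A) (F : A → Bool) →
             ∣ tabulate {n = length xs} (λ i → F (lookup xs i)) ∣ ≡ sum (map (𝟙 ∘ F) xs)
∣tabulate∣ [] F = refl
∣tabulate∣ (x ∷ xs) F with F x
... | true = cong suc (∣tabulate∣ xs F)
... | false = ∣tabulate∣ xs F

-- T_n(S), n = m + 2, as the disjoint union over blocks t ≤ m of the grids [0, t] × [0, m − t].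
record BlockCoordinates (m : ℕ) (S : List Color) : Set where
  private
    n : ℕ
    n = suc (suc m)
  field
    block row col : Pt → ℕ
    point : ℕ → ℕ → ℕ → Pt
    point-InT : ∀ t u v → u ≤ t → t + v ≤ m → InT n (point t u v)
    coordinates-point : ∀ t u v → u ≤ t → block (point t u v) ≡ t × row (point t u v) ≡ u × col (point t u v) ≡ v
    point-coordinates : ∀ p → point (block p) (row p) (col p) ≡ p
    coordinates-bounded : ∀ p → InT n p → row p ≤ block p × block p + col p ≤ m
    generator-step : ∀ {p p′} → Gen n S p p′ →
      (block p′ ≡ block p × row p′ ≡ row p × col p′ ≡ suc (col p)) ⊎
      (block p′ ≡ block p × row p′ ≡ suc (row p) × col p′ ≡ col p)
    col-generator : ∀ t u v → u ≤ t → t + suc v ≤ m → Gen n S (point t u v) (point t u (suc v))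
    row-generator : ∀ t u v → suc u ≤ t → t + v ≤ m → Gen n S (point t u v) (point t (suc u) v)
    sum-by-blocks : ∀ (f : Pt → ℕ) → sum (map f (ptsT n)) ≡
      ∑ (suc m) (λ t → ∑ (suc t) (λ u → ∑ (suc (m ∸ t)) (λ v → f (point t u v))))

module BlockIdeals (m : ℕ) (S : List Color) (C : BlockCoordinates m S) where
  open BlockCoordinates C

  n : ℕ
  n = suc (suc m)

  rows : ℕ → List (List ℕ)
  rows t = boxPartitions (suc t) (suc (m ∸ t))

  families : List (List (List ℕ))
  families = choices (applyUpTo rows (suc m))

  height : List (List ℕ) → ℕ → ℕ → ℕ
  height H t u = lookupOr 0 (lookupOr [] H t) u

  below : List (List ℕ) → Pt → Bool
  below H p = col p <ᵇ height H (block p) (row p)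

  toIdeal : List (List ℕ) → Subset (sizeT n)
  toIdeal H = tabulate (λ i → below H (elt n i))

  ∈-toIdeal⁺ : ∀ H i → below H (elt n i) ≡ true → i ∈ₛ toIdeal H
  ∈-toIdeal⁺ H i eq = lookup⇒[]= i (toIdeal H) (trans (lookup∘tabulate (λ j → below H (elt n j)) i) eq)

  ∈-toIdeal⁻ : ∀ H i → i ∈ₛ toIdeal H → below H (elt n i) ≡ true
  ∈-toIdeal⁻ H i i∈ = trans (sym (lookup∘tabulate (λ j → below H (elt n j)) i)) ([]=⇒lookup i∈)

  block<1+m : ∀ {t v} → t + v ≤ m → t < suc m
  block<1+m {t} {v} t+v≤m = s≤s (m+n≤o⇒m≤o t t+v≤m)

  col<1+m∸block : ∀ {t v} → t + v ≤ m → v < suc (m ∸ t)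
  col<1+m∸block {t} {v} t+v≤m = s≤s (m+n≤o⇒m≤o∸n v (subst (_≤ m) (+-comm t v) t+v≤m))

  block+col≤m : ∀ {t v} → t < suc m → v < suc (m ∸ t) → t + v ≤ m
  block+col≤m {t} {v} t≤m v≤m-t = subst (t + v ≤_) (m+[n∸m]≡n (≤-pred t≤m)) (+-monoʳ-≤ t (≤-pred v≤m-t))

  module _ {H} (H∈ : H ∈ families) where

    length-family : length H ≡ suc m
    length-family = proj₁ (∈-choices⁻ [] (suc m) rows H∈)

    row-isBoxPartition : ∀ t → t < suc m → IsBoxPartition (suc t) (suc (m ∸ t)) (lookupOr [] H t)
    row-isBoxPartition t t≤m = ∈-boxPartitions⁻ (suc t) (suc (m ∸ t)) (proj₂ (∈-choices⁻ [] (suc m) rows H∈) t t≤m)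

    height-decreasing : ∀ t u → t < suc m → height H t (suc u) ≤ height H t u
    height-decreasing t u t≤m = proj₂ (proj₂ (row-isBoxPartition t t≤m)) u

    height-bounded : ∀ t u → t < suc m → height H t u ≤ suc (m ∸ t)
    height-bounded t u t≤m = proj₁ (proj₂ (row-isBoxPartition t t≤m)) u

    below-step : ∀ {p p′} → Gen n S p p′ → below H p′ ≡ true → below H p ≡ true
    below-step {p} {p′} gen@(_ , _ , _ , p∈T , _) below-p′ with generator-step gen
    ... | inj₁ (t≡ , u≡ , v≡) = <ᵇ-true (≤-trans (n≤1+n _)
          (subst₂ _<_ v≡ (cong₂ (height H) t≡ u≡) (<ᵇ-true⁻ below-p′)))
    ... | inj₂ (t≡ , u≡ , v≡) = <ᵇ-true (≤-trans
          (subst₂ _<_ v≡ (cong₂ (height H) t≡ u≡) (<ᵇ-true⁻ below-p′))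
          (height-decreasing (block p) (row p) (block<1+m (proj₂ (coordinates-bounded p p∈T)))))

    below-≼ : ∀ {p p′} → p ≼[ n , S ] p′ → below H p′ ≡ true → below H p ≡ true
    below-≼ ε★ below-p′ = below-p′
    below-≼ (gen ◅ steps) below-p′ = below-step gen (below-≼ steps below-p′)

    toIdeal-isIdeal : IsIdeal n S (toIdeal H)
    toIdeal-isIdeal i j j≼i i∈ = ∈-toIdeal⁺ H j (below-≼ j≼i (∈-toIdeal⁻ H i i∈))

    below-point : ∀ t u v → u ≤ t → below H (point t u v) ≡ (v <ᵇ height H t u)
    below-point t u v u≤t with coordinates-point t u v u≤t
    ... | t≡ , u≡ , v≡ = cong₂ _<ᵇ_ v≡ (cong₂ (height H) t≡ u≡)

    ∣toIdeal∣ : ∣ toIdeal H ∣ ≡ sum (map sum H)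
    ∣toIdeal∣ = begin
      ∣ toIdeal H ∣
        ≡⟨ ∣tabulate∣ (ptsT n) (below H) ⟩
      sum (map (𝟙 ∘ below H) (ptsT n))
        ≡⟨ sum-by-blocks (𝟙 ∘ below H) ⟩
      ∑ (suc m) (λ t → ∑ (suc t) (λ u → ∑ (suc (m ∸ t)) (λ v → 𝟙 (below H (point t u v)))))
        ≡⟨ Sum.cong< (suc m) (λ t t≤m → Sum.cong< (suc t) (λ u u≤t →
             trans (Sum.cong< (suc (m ∸ t)) (λ v _ → cong 𝟙 (below-point t u v (≤-pred u≤t))))
                   (∑𝟙-<ᵇ (suc (m ∸ t)) (height H t u) (height-bounded t u t≤m)))) ⟩
      ∑ (suc m) (λ t → ∑ (suc t) (height H t))
        ≡⟨ Sum.cong< (suc m) (λ t t≤m → sym (trans (sum-map-row t) (cong (λ l → ∑ l (height H t)) (proj₁ (row-isBoxPartition t t≤m))))) ⟩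
      ∑ (suc m) (λ t → sum (lookupOr [] H t))
        ≡⟨ sym (trans (cong (λ F → sum (map sum F)) (sym (applyUpTo-lookupOr [] H)))
                      (trans (sum-map-applyUpTo (length H) sum (lookupOr [] H)) (cong (λ l → ∑ l (λ t → sum (lookupOr [] H t))) length-family))) ⟩
      sum (map sum H) ∎
      where
      open ≡-Reasoning
      sum-map-row : ∀ t → sum (lookupOr [] H t) ≡ ∑ (length (lookupOr [] H t)) (height H t)
      sum-map-row t = trans (cong sum (sym (applyUpTo-lookupOr 0 (lookupOr [] H t))))
                            (Sum.foldr-applyUpTo (length (lookupOr [] H t)) (height H t))

  _∈ᴾ_ : Pt → Subset (sizeT n) → Set
  p ∈ᴾ I = ∃ λ i → elt n i ≡ p × i ∈ₛ I

  _∈ᴾ?_ : ∀ p I → Dec (p ∈ᴾ I)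
  p ∈ᴾ? I = any? (λ i → ≡-dec _≟_ (≡-dec _≟_ _≟_) (elt n i) p ×-dec (i ∈? I))

  ∈ᴾ?-toIdeal : ∀ H {p} → InT n p → does (p ∈ᴾ? toIdeal H) ≡ below H p
  ∈ᴾ?-toIdeal H {p} p∈T = does-≡ (p ∈ᴾ? toIdeal H)
    (λ { (i , refl , i∈) → ∈-toIdeal⁻ H i i∈ })
    (λ below-p → let (i , eltᵢ≡p) = InT⇒elt n p∈T in
                 i , eltᵢ≡p , ∈-toIdeal⁺ H i (trans (cong (below H) eltᵢ≡p) below-p))

  heights : Subset (sizeT n) → ℕ → ℕ → ℕ
  heights I t u = ∑ (suc (m ∸ t)) (λ v → 𝟙 (does (point t u v ∈ᴾ? I)))

  toFamily : Subset (sizeT n) → List (List ℕ)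
  toFamily I = applyUpTo (λ t → applyUpTo (heights I t) (suc t)) (suc m)

  module _ {I} (I-ideal : IsIdeal n S I) where

    ∈ᴾ-step : ∀ {p p′} → Gen n S p p′ → p′ ∈ᴾ I → p ∈ᴾ I
    ∈ᴾ-step {p} {p′} gen@(_ , _ , _ , p∈T , _) (i , eltᵢ≡p′ , i∈) with InT⇒elt n p∈T
    ... | j , eltⱼ≡p = j , eltⱼ≡p ,
      I-ideal i j (subst₂ _≼[ n , S ]_ (sym eltⱼ≡p) (sym eltᵢ≡p′) (gen ◅ ε★)) i∈

    -- Should T_n list a point twice, an ideal contains both copies or neither.
    lookup-ideal : ∀ i → Vec.lookup I i ≡ does (elt n i ∈ᴾ? I)
    lookup-ideal i = sym (does-≡ (elt n i ∈ᴾ? I)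
      (λ { (j , eltⱼ≡eltᵢ , j∈) → []=⇒lookup (I-ideal j i (subst (λ p → p ≼[ n , S ] elt n j) eltⱼ≡eltᵢ ε★) j∈) })
      (λ lookup≡true → i , refl , lookup⇒[]= i I lookup≡true))

    heights-threshold : ∀ t u v → t < suc m → u ≤ t → v < suc (m ∸ t) →
                        does (point t u v ∈ᴾ? I) ≡ (v <ᵇ heights I t u)
    heights-threshold t u v t≤m u≤t = downClosed⇒threshold (suc (m ∸ t)) (λ v → does (point t u v ∈ᴾ? I)) down-closed v
      where
      down-closed : DownClosed (suc (m ∸ t)) (λ v → does (point t u v ∈ᴾ? I))
      down-closed v v<m-t in-I = dec-true (point t u v ∈ᴾ? I)
        (∈ᴾ-step (col-generator t u v u≤t (block+col≤m t≤m v<m-t)) (does-true⁻ (point t u (suc v) ∈ᴾ? I) in-I))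

    heights-decreasing : ∀ t u → t < suc m → suc u ≤ t → heights I t (suc u) ≤ heights I t u
    heights-decreasing t u t≤m u<t = ∑-mono-≤ (suc (m ∸ t)) pointwise
      where
      pointwise : ∀ v → v < suc (m ∸ t) → 𝟙 (does (point t (suc u) v ∈ᴾ? I)) ≤ 𝟙 (does (point t u v ∈ᴾ? I))
      pointwise v v≤m-t with does (point t (suc u) v ∈ᴾ? I) in in-I
      ... | false = z≤n
      ... | true = ≤-reflexive (cong 𝟙 (sym (dec-true (point t u v ∈ᴾ? I)
          (∈ᴾ-step (row-generator t u v u<t (block+col≤m t≤m v≤m-t)) (does-true⁻ (point t (suc u) v ∈ᴾ? I) in-I)))))

    toFamily∈families : toFamily I ∈ families
    toFamily∈families = ∈-choices⁺ (suc m) rows (λ t → applyUpTo (heights I t) (suc t)) λ t t≤m →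
      ∈-boxPartitions⁺ (suc t) (suc (m ∸ t)) (heights I t)
        (λ u _ → ∑𝟙≤ (suc (m ∸ t)) (λ v → does (point t u v ∈ᴾ? I)))
        (λ u u<t → heights-decreasing t u t≤m (≤-pred u<t))

    height-toFamily : ∀ t u → t < suc m → u ≤ t → height (toFamily I) t u ≡ heights I t u
    height-toFamily t u t≤m u≤t =
      trans (cong (λ r → lookupOr 0 r u) (lookupOr-applyUpTo [] (suc m) (λ t → applyUpTo (heights I t) (suc t)) t t≤m))
            (lookupOr-applyUpTo 0 (suc t) (heights I t) u (s≤s u≤t))

    toIdeal∘toFamily : toIdeal (toFamily I) ≡ I
    toIdeal∘toFamily = trans (tabulate-cong pointwise) (tabulate∘lookup I)
      where
      pointwise : ∀ i → below (toFamily I) (elt n i) ≡ Vec.lookup I i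
      pointwise i = begin
        below (toFamily I) p                    ≡⟨ cong (col p <ᵇ_) (height-toFamily (block p) (row p) t≤m u≤t) ⟩
        col p <ᵇ heights I (block p) (row p)     ≡⟨ sym (heights-threshold (block p) (row p) (col p) t≤m u≤t v≤m-t) ⟩
        does (point (block p) (row p) (col p) ∈ᴾ? I) ≡⟨ cong (λ p′ → does (p′ ∈ᴾ? I)) (point-coordinates p) ⟩
        does (p ∈ᴾ? I)                          ≡⟨ sym (lookup-ideal i) ⟩
        Vec.lookup I i                          ∎
        where
        open ≡-Reasoning
        p : Pt
        p = elt n i
        u≤t : row p ≤ block p
        u≤t = proj₁ (coordinates-bounded p (elt-InT n i))
        t≤m : block p < suc m
        t≤m = block<1+m (proj₂ (coordinates-bounded p (elt-InT n i)))
        v≤m-t : col p < suc (m ∸ block p)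
        v≤m-t = col<1+m∸block (proj₂ (coordinates-bounded p (elt-InT n i)))

  toFamily∘toIdeal : ∀ {H} → H ∈ families → toFamily (toIdeal H) ≡ H
  toFamily∘toIdeal {H} H∈ = begin
    toFamily (toIdeal H)           ≡⟨ applyUpTo-cong< (suc m) row-eq ⟩
    applyUpTo (lookupOr [] H) (suc m) ≡⟨ cong (applyUpTo (lookupOr [] H)) (sym (length-family H∈)) ⟩
    applyUpTo (lookupOr [] H) (length H) ≡⟨ applyUpTo-lookupOr [] H ⟩
    H                              ∎
    where
    open ≡-Reasoning
    heights-toIdeal : ∀ t u → t < suc m → u ≤ t → heights (toIdeal H) t u ≡ height H t u
    heights-toIdeal t u t≤m u≤t = trans
      (Sum.cong< (suc (m ∸ t)) (λ v v≤m-t → cong 𝟙 (trans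
        (∈ᴾ?-toIdeal H (point-InT t u v u≤t (block+col≤m t≤m v≤m-t)))
        (below-point H∈ t u v u≤t))))
      (∑𝟙-<ᵇ (suc (m ∸ t)) (height H t u) (height-bounded H∈ t u t≤m))
    row-eq : ∀ t → t < suc m → applyUpTo (heights (toIdeal H) t) (suc t) ≡ lookupOr [] H t
    row-eq t t≤m = begin
      applyUpTo (heights (toIdeal H) t) (suc t)   ≡⟨ applyUpTo-cong< (suc t) (λ u u≤t → heights-toIdeal t u t≤m (≤-pred u≤t)) ⟩
      applyUpTo (height H t) (suc t)              ≡⟨ cong (applyUpTo (height H t)) (sym (proj₁ (row-isBoxPartition H∈ t t≤m))) ⟩
      applyUpTo (height H t) (length (lookupOr [] H t)) ≡⟨ applyUpTo-lookupOr 0 (lookupOr [] H t) ⟩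
      lookupOr [] H t                             ∎

  ideals : List (Subset (sizeT n))
  ideals = map toIdeal families

  ideals-unique : Unique ideals
  ideals-unique = UP.map⁻ (subst Unique (sym toFamily-ideals) families-unique)
    where
    families-unique : Unique families
    families-unique = choices-unique _ (applyUpTo⁺₂ rows (suc m) (λ t → boxPartitions-unique (suc t) (suc (m ∸ t))))
    toFamily-ideals : map toFamily ideals ≡ families
    toFamily-ideals = trans (sym (map-∘ families)) (map-id-local (All.tabulate toFamily∘toIdeal))

  ∈ideals⇔IsIdeal : ∀ I → I ∈ ideals ⇔ IsIdeal n S I
  ∈ideals⇔IsIdeal I = mk⇔
    (λ I∈ → let (H , H∈ , I≡) = ∈-map⁻ toIdeal I∈ in subst (IsIdeal n S) (sym I≡) (toIdeal-isIdeal H∈))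
    (λ I-ideal → subst (_∈ ideals) (toIdeal∘toFamily I-ideal) (∈-map⁺ toIdeal (toFamily∈families I-ideal)))

  genSum-ideals : ∀ q → genSum ideals q ≡ ∏ (suc m) (λ t → boxGF q (suc t) (suc (m ∸ t)))
  genSum-ideals q = begin
    sum (map (λ I → q ^ ∣ I ∣) (map toIdeal families))     ≡⟨ cong sum (sym (map-∘ families)) ⟩
    sum (map (λ H → q ^ ∣ toIdeal H ∣) families)           ≡⟨ cong sum (map-cong-local (All.tabulate (λ H∈ → cong (q ^_) (∣toIdeal∣ H∈)))) ⟩
    sum (map (λ H → q ^ sum (map sum H)) families)         ≡⟨ sum-map-choices q sum (applyUpTo rows (suc m)) ⟩
    product (map (λ xs → sum (map (λ ys → q ^ sum ys) xs)) (applyUpTo rows (suc m)))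
      ≡⟨ product-map-applyUpTo (suc m) (λ xs → sum (map (λ ys → q ^ sum ys) xs)) rows ⟩
    ∏ (suc m) (λ t → boxGF q (suc t) (suc (m ∸ t))) ∎
    where open ≡-Reasoning

swap₁₂ swap₂₃ : Pt → Pt
swap₁₂ (a₁ , a₂ , a₃) = a₂ , a₁ , a₃
swap₂₃ (a₁ , a₂ , a₃) = a₁ , a₃ , a₂

module TripleSums (m : ℕ) where
  private
    M : ℕ
    M = suc m

  triple : (Pt → ℕ) → ℕ
  triple f = ∑ M (λ a₁ → ∑ (M ∸ a₁) (λ a₂ → ∑ (M ∸ a₁ ∸ a₂) (λ a₃ → f (a₁ , a₂ , a₃))))

  sum-map-ptsT≡triple : ∀ f → sum (map f (ptsT (suc (suc m)))) ≡ triple f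
  sum-map-ptsT≡triple f = trans (sum-map-ptsT (suc (suc m)) f) (Sum.cong< M (λ a₁ a₁≤m →
    trans (Sum.cong< (suc (m ∸ a₁)) (λ a₂ a₂≤m-a₁ → cong (λ l → ∑ l (λ a₃ → f (a₁ , a₂ , a₃)))
             (trans (sym (+-∸-assoc 1 (≤-pred a₂≤m-a₁))) (cong (_∸ a₂) (sym (+-∸-assoc 1 (≤-pred a₁≤m)))))))
          (cong (λ l → ∑ l (λ a₂ → ∑ (M ∸ a₁ ∸ a₂) (λ a₃ → f (a₁ , a₂ , a₃)))) (sym (+-∸-assoc 1 (≤-pred a₁≤m))))))

  triple-swap₂₃ : ∀ f → triple f ≡ triple (f ∘ swap₂₃)
  triple-swap₂₃ f = Sum.cong< M (λ a₁ _ → Sum.triangle-swap (M ∸ a₁) (λ a₂ a₃ → f (a₁ , a₂ , a₃)))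

  triple-swap₁₂ : ∀ f → triple f ≡ triple (f ∘ swap₁₂)
  triple-swap₁₂ f = trans (Sum.triangle-swap M (λ a₁ a₂ → ∑ (M ∸ a₁ ∸ a₂) (λ a₃ → f (a₁ , a₂ , a₃))))
    (Sum.cong< M (λ a₂ _ → Sum.cong< (M ∸ a₂) (λ a₁ _ → cong (λ l → ∑ l (λ a₃ → f (a₁ , a₂ , a₃))) (∸-comm M a₁ a₂))))
    where
    ∸-comm : ∀ k i j → k ∸ i ∸ j ≡ k ∸ j ∸ i
    ∸-comm k i j = trans (∸-+-assoc k i j) (trans (cong (k ∸_) (+-comm i j)) (sym (∸-+-assoc k j i)))

  triple-by-blocks : ∀ f → triple f ≡ ∑ M (λ t → ∑ (suc t) (λ u → ∑ (suc (m ∸ t)) (λ v → f (t ∸ u , u , v))))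
  triple-by-blocks f = trans (Sum.triangle M (λ a₁ a₂ → ∑ (M ∸ a₁ ∸ a₂) (λ a₃ → f (a₁ , a₂ , a₃))))
    (Sum.cong< M (λ t t≤m → Sum.cong< (suc t) (λ u u≤t → cong (λ l → ∑ l (λ v → f (t ∸ u , u , v))) (bound t u t≤m u≤t))))
    where
    bound : ∀ t u → t < M → u < suc t → M ∸ (t ∸ u) ∸ u ≡ suc (m ∸ t)
    bound t u t≤m u≤t = begin
      M ∸ (t ∸ u) ∸ u    ≡⟨ ∸-+-assoc M (t ∸ u) u ⟩
      M ∸ (t ∸ u + u)    ≡⟨ cong (M ∸_) (m∸n+n≡m (≤-pred u≤t)) ⟩
      M ∸ t              ≡⟨ +-∸-assoc 1 (≤-pred t≤m) ⟩
      suc (m ∸ t)        ∎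
      where open ≡-Reasoning

∸-suc : ∀ {t u} → u < t → t ∸ u ≡ suc (t ∸ suc u)
∸-suc {suc t} (s≤s u≤t) = +-∸-assoc 1 u≤t

module _ (m : ℕ) where
  open TripleSums m
  private
    n : ℕ
    n = suc (suc m)
    +-suc-≤⇒≤ : ∀ t v → t + suc v ≤ m → t + v ≤ m
    +-suc-≤⇒≤ t v t+v<m = ≤-trans (+-monoʳ-≤ t (n≤1+n v)) t+v<m

  by-blocks : BlockCoordinates m (b ∷ y ∷ [])
  by-blocks = record
    { block = λ { (a₁ , a₂ , _) → a₁ + a₂ }
    ; row = λ { (_ , a₂ , _) → a₂ }
    ; col = λ { (_ , _ , a₃) → a₃ }
    ; point = λ t u v → t ∸ u , u , v
    ; point-InT = point-InT
    ; coordinates-point = λ t u v u≤t → m∸n+n≡m u≤t , refl , refl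
    ; point-coordinates = λ { (a₁ , a₂ , a₃) → cong (_, a₂ , a₃) (m+n∸n≡m a₁ a₂) }
    ; coordinates-bounded = λ { (a₁ , a₂ , _) p∈T → m≤n+m a₂ a₁ , p∈T }
    ; generator-step = λ { (_ , there (here refl) , step-y , _) → inj₁ (refl , refl , refl)
                       ; (_ , here refl , step-b {a₁} {a₂} , _) → inj₂ (+-suc a₁ a₂ , refl , refl)
                       ; (_ , there (there ()) , _) }
    ; col-generator = λ t u v u≤t t+v<m →
        y , there (here refl) , step-y , point-InT t u v u≤t (+-suc-≤⇒≤ t v t+v<m) , point-InT t u (suc v) u≤t t+v<m
    ; row-generator = λ t u v u<t t+v≤m →
        b , here refl , subst (λ a₁ → Step b (a₁ , u , v) (t ∸ suc u , suc u , v)) (sym (∸-suc u<t)) step-b ,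
        point-InT t u v (<⇒≤ u<t) t+v≤m , point-InT t (suc u) v u<t t+v≤m
    ; sum-by-blocks = λ f → trans (sum-map-ptsT≡triple f) (triple-by-blocks f)
    }
    where
    point-InT : ∀ t u v → u ≤ t → t + v ≤ m → InT n (t ∸ u , u , v)
    point-InT t u v u≤t = subst (_≤ m) (cong (_+ v) (sym (m∸n+n≡m u≤t)))

  go-blocks : BlockCoordinates m (g ∷ o ∷ [])
  go-blocks = record
    { block = λ { (a₁ , _ , a₃) → a₁ + a₃ }
    ; row = λ { (_ , _ , a₃) → a₃ }
    ; col = λ { (_ , a₂ , _) → a₂ }
    ; point = λ t u v → t ∸ u , v , u
    ; point-InT = point-InT
    ; coordinates-point = λ t u v u≤t → m∸n+n≡m u≤t , refl , refl
    ; point-coordinates = λ { (a₁ , a₂ , a₃) → cong (_, a₂ , a₃) (m+n∸n≡m a₁ a₃) }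
    ; coordinates-bounded = λ { (a₁ , a₂ , a₃) p∈T → m≤n+m a₃ a₁ , subst (_≤ m) (+-swap₂₃ a₁ a₂ a₃) p∈T }
    ; generator-step = λ { (_ , here refl , step-g , _) → inj₁ (refl , refl , refl)
                       ; (_ , there (here refl) , step-o {a₁} {_} {a₃} , _) → inj₂ (+-suc a₁ a₃ , refl , refl)
                       ; (_ , there (there ()) , _) }
    ; col-generator = λ t u v u≤t t+v<m →
        g , here refl , step-g , point-InT t u v u≤t (+-suc-≤⇒≤ t v t+v<m) , point-InT t u (suc v) u≤t t+v<m
    ; row-generator = λ t u v u<t t+v≤m →
        o , there (here refl) , subst (λ a₁ → Step o (a₁ , v , u) (t ∸ suc u , v , suc u)) (sym (∸-suc u<t)) step-o ,
        point-InT t u v (<⇒≤ u<t) t+v≤m , point-InT t (suc u) v u<t t+v≤m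
    ; sum-by-blocks = λ f → trans (sum-map-ptsT≡triple f) (trans (triple-swap₂₃ f) (triple-by-blocks (f ∘ swap₂₃)))
    }
    where
    +-swap₂₃ : ∀ a₁ a₂ a₃ → a₁ + a₂ + a₃ ≡ a₁ + a₃ + a₂
    +-swap₂₃ = solve-∀
    point-InT : ∀ t u v → u ≤ t → t + v ≤ m → InT n (t ∸ u , v , u)
    point-InT t u v u≤t = subst (_≤ m) (trans (cong (_+ v) (sym (m∸n+n≡m u≤t))) (+-swap₂₃ (t ∸ u) u v))

  rs-blocks : BlockCoordinates m (r ∷ s ∷ [])
  rs-blocks = record
    { block = λ { (_ , a₂ , a₃) → a₂ + a₃ }
    ; row = λ { (_ , a₂ , _) → a₂ }
    ; col = λ { (a₁ , _ , _) → a₁ }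
    ; point = λ t u v → v , u , t ∸ u
    ; point-InT = point-InT
    ; coordinates-point = λ t u v u≤t → m+[n∸m]≡n u≤t , refl , refl
    ; point-coordinates = λ { (a₁ , a₂ , a₃) → cong (λ a₃′ → a₁ , a₂ , a₃′) (m+n∸m≡n a₂ a₃) }
    ; coordinates-bounded = λ { (a₁ , a₂ , a₃) p∈T → m≤m+n a₂ a₃ , subst (_≤ m) (rotate a₁ a₂ a₃) p∈T }
    ; generator-step = λ { (_ , here refl , step-r , _) → inj₁ (refl , refl , refl)
                       ; (_ , there (here refl) , step-s {_} {a₂} {a₃} , _) → inj₂ (sym (+-suc a₂ a₃) , refl , refl)
                       ; (_ , there (there ()) , _) }
    ; col-generator = λ t u v u≤t t+v<m →
        r , here refl , step-r , point-InT t u v u≤t (+-suc-≤⇒≤ t v t+v<m) , point-InT t u (suc v) u≤t t+v<m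
    ; row-generator = λ t u v u<t t+v≤m →
        s , there (here refl) , subst (λ a₃ → Step s (v , u , a₃) (v , suc u , t ∸ suc u)) (sym (∸-suc u<t)) step-s ,
        point-InT t u v (<⇒≤ u<t) t+v≤m , point-InT t (suc u) v u<t t+v≤m
    -- (a₁ , a₂ , a₃) ↦ (a₃ , a₂ , a₁) as a product of three transpositions
    ; sum-by-blocks = λ f → trans (sum-map-ptsT≡triple f) (trans (triple-swap₁₂ f) (trans (triple-swap₂₃ (f ∘ swap₁₂))
                             (trans (triple-swap₁₂ (f ∘ swap₁₂ ∘ swap₂₃)) (triple-by-blocks (f ∘ swap₁₂ ∘ swap₂₃ ∘ swap₁₂)))))
    }
    where
    rotate : ∀ a₁ a₂ a₃ → a₁ + a₂ + a₃ ≡ a₂ + a₃ + a₁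
    rotate = solve-∀
    point-InT : ∀ t u v → u ≤ t → t + v ≤ m → InT n (v , u , t ∸ u)
    point-InT t u v u≤t = subst (_≤ m) (trans (+-comm t v) (trans (cong (λ w → v + w) (sym (m+[n∸m]≡n u≤t))) (sym (+-assoc v u (t ∸ u)))))

theorem-for-blocks : ∀ m S → BlockCoordinates m S → ∀ (q : ℕ) →
  Σ (List (Subset (sizeT (suc (suc m))))) (λ L →
    Unique L ×
    (∀ I → (I ∈ L) ⇔ IsIdeal (suc (suc m)) S I) ×
    ((+ genSum L q) / 1 ≡ prodBinom (suc (suc m)) q) ×
    (prodBinom (suc (suc m)) q ≡ prodRatio (suc (suc m)) q))
theorem-for-blocks m S C q = ideals , ideals-unique , ∈ideals⇔IsIdeal , ideals-count , prodBinom≡prodRatio q (suc (suc m))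
  where
  open BlockIdeals m S C
  open ≡-Reasoning
  ideals-count : (+ genSum ideals q) / 1 ≡ prodBinom (suc (suc m)) q
  ideals-count = begin
    + genSum ideals q / 1
      ≡⟨ cong (λ x → + x / 1) (genSum-ideals q) ⟩
    + ∏ (suc m) (λ t → boxGF q (suc t) (suc (m ∸ t))) / 1
      ≡⟨ cong (λ x → + x / 1) (Prod.cong< (suc m) (λ t t≤m → cong (boxGF q (suc t)) (sym (+-∸-assoc 1 (≤-pred t≤m))))) ⟩
    + ∏ (suc m) (λ t → boxGF q (suc t) (suc m ∸ t)) / 1
      ≡⟨ ∏boxGF≡prodBinom q (suc m) ⟩
    prodBinom (suc (suc m)) q ∎

theorem8 : ∀ (n : ℕ) → 2 ≤ n → ∀ (S : List Color) →
           (S ≡ g ∷ o ∷ [] ⊎ S ≡ r ∷ s ∷ [] ⊎ S ≡ b ∷ y ∷ []) →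
           ∀ (q : ℕ) →
           Σ (List (Subset (sizeT n))) (λ L →
             Unique L ×
             (∀ I → (I ∈ L) ⇔ IsIdeal n S I) ×
             ((+ genSum L q) / 1 ≡ prodBinom n q) ×
             (prodBinom n q ≡ prodRatio n q))
theorem8 (suc (suc m)) (s≤s (s≤s z≤n)) S (inj₁ refl) = theorem-for-blocks m S (go-blocks m)
theorem8 (suc (suc m)) (s≤s (s≤s z≤n)) S (inj₂ (inj₁ refl)) = theorem-for-blocks m S (rs-blocks m)
theorem8 (suc (suc m)) (s≤s (s≤s z≤n)) S (inj₂ (inj₂ refl)) = theorem-for-blocks m S (by-blocks m)
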